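{- Let $r \ge 2$ and $a \ge 2$ both be even, and let $s \ge 0$ and $t \ge 1$ be integers. Then $\sigma(r,s,a,t) \le r \left\lceil \frac{tr+s-1}{a} \right\rceil + (t-1)r$.
   Context: All graphs are finite simple graphs. A $(d,d+s)$-graph is a graph all of whose vertex degrees lie in $\{d, \ldots, d+s\}$. An $(r,r+a)$-factor of $G$ is a spanning subgraph all of whose degrees lie in $\{r,\ldots,r+a\}$; an $(r,r+a)$-factorization of $G$ with $x$ factors is a decomposition of $E(G)$ into $x$ edge-disjoint $(r,r+a)$-factors. $\sigma(r,s,a,t)$ is the least integer such that, whenever $d \ge \sigma(r,s,a,t)$, every simple $(d,d+s)$-graph has an $(r,r+a)$-factorization with $x$ factors for at least $t$ different values of $x$. -}

module Defs where

open import Data.Nat using (ℕ; zero; suc; _+_; _*_; _∸_; _≤_; NonZero)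
open import Data.Nat.DivMod using (_/_)
open import Data.Bool using (Bool; true; false; if_then_else_; _∧_)
open import Data.Fin using (Fin)
import Data.Fin as Fin
open import Data.List using (List; map; allFin)
open import Data.Nat.ListAction using (sum)
open import Data.Product using (Σ; _×_; _,_)
open import Function.Definitions using (Injective)
open import Relation.Binary.PropositionalEquality using (_≡_)
open import Relation.Nullary using (does)

record Graph (n : ℕ) : Set where
  field
    adj    : Fin n → Fin n → Bool
    sym    : ∀ i j → adj i j ≡ adj j i
    irrefl : ∀ i → adj i i ≡ false
open Graph public

countB : ∀ {n} → (Fin n → Bool) → ℕ
countB {n} p = sum (map (λ j → if p j then 1 else 0) (allFin n))

degree : ∀ {n} → Graph n → Fin n → ℕ
degree G v = countB (adj G v)

IsDegRangeGraph : ∀ {n} → ℕ → ℕ → Graph n → Set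
IsDegRangeGraph {n} d s G = ∀ (v : Fin n) → d ≤ degree G v × degree G v ≤ d + s

-- A decomposition of E(G) into x edge-disjoint spanning subgraphs is an
-- edge colouring c with colours Fin x (c is only meaningful on edges, and
-- must be symmetric there). Factor k consists of edges of colour k.
degreeIn : ∀ {n x} → Graph n → (Fin n → Fin n → Fin x) → Fin x → Fin n → ℕ
degreeIn G c k v = countB (λ j → adj G v j ∧ does (c v j Fin.≟ k))

HasFactorization : ∀ {n} → Graph n → ℕ → ℕ → ℕ → Set
HasFactorization {n} G r a x =
  Σ (Fin n → Fin n → Fin x) λ c →
    (∀ i j → adj G i j ≡ true → c i j ≡ c j i) ×
    (∀ (k : Fin x) (v : Fin n) → r ≤ degreeIn G c k v × degreeIn G c k v ≤ r + a)

HasManyFactorizations : ∀ {n} → Graph n → ℕ → ℕ → ℕ → Set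
HasManyFactorizations G r a t =
  Σ (Fin t → ℕ) λ f → Injective _≡_ _≡_ f × (∀ i → HasFactorization G r a (f i))

ceilDiv : (m a : ℕ) → .{{NonZero a}} → ℕ
ceilDiv m a = (m + a ∸ 1) / a

module Submission where

-- If r = 2p and a = 2b are even and every degree of G lies between r x and (r + a) x, then G
-- has an (r, r + a)-factorization with x factors. Orient the edges so that in- and out-degree
-- differ by at most one everywhere (replace two edges u–v, v–w by u–w and recurse), so both
-- lie between p x and (p + b) x. Cut the arcs leaving, and those entering, each vertex into
-- blocks of x and let each block be a vertex of a bipartite graph with one edge per arc; its
-- maximum degree is x, so by König's theorem it has a proper x-edge-colouring. A full block
-- meets every colour once, and no block meets a colour twice, so every colour class has
-- between 2p and 2(p + b) edges at every vertex. For a (d, d + s)-graph the t numbers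
-- x = ⌊d/r⌋ - i, i < t, satisfy r x ≤ d and d + s ≤ (r + a) x as soon as d reaches the bound.

module Sums where

  open import Data.Nat using (ℕ; zero; suc; _+_; _≤_; _<_; z≤n; s≤s)
  open import Data.Nat.Properties
  open import Data.Bool using (Bool; true; false; if_then_else_)
  open import Data.Fin using (Fin; zero; suc)
  import Data.Fin.Properties as FP
  open import Data.List using (List; []; _∷_; map; _++_; length; allFin; filterᵇ; cartesianProduct)
  import Data.List.Properties as LP
  open import Data.List.Relation.Unary.All using (All; []; _∷_)
  open import Data.List.Relation.Unary.Any using (here; there)
  open import Data.List.Membership.Propositional using (_∈_)
  open import Data.Nat.ListAction using (sum)
  open import Data.Product using (_×_; _,_)
  open import Algebra.Properties.CommutativeSemigroup +-commutativeSemigroup using (interchange)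
  open import Relation.Binary.PropositionalEquality
  open import Relation.Binary.Definitions using (DecidableEquality)
  open import Relation.Nullary using (does)
  open import Relation.Nullary.Decidable using (dec-true; dec-false)
  open import Function using (_∘_)

  ind : Bool → ℕ
  ind true = 1
  ind false = 0

  ind≤1 : ∀ b → ind b ≤ 1
  ind≤1 true = s≤s z≤n
  ind≤1 false = z≤n

  does-refl : ∀ {A : Set} (_≟_ : DecidableEquality A) (a : A) → does (a ≟ a) ≡ true
  does-refl _≟_ a = dec-true (a ≟ a) refl

  does-no : ∀ {A : Set} (_≟_ : DecidableEquality A) {a b : A} → a ≢ b → does (a ≟ b) ≡ false
  does-no _≟_ {a} {b} = dec-false (a ≟ b)

  sumBy : ∀ {A : Set} → (A → ℕ) → List A → ℕ
  sumBy w [] = 0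
  sumBy w (x ∷ xs) = w x + sumBy w xs

  module _ {A : Set} where
    sumBy-++ : (w : A → ℕ) (xs ys : List A) → sumBy w (xs ++ ys) ≡ sumBy w xs + sumBy w ys
    sumBy-++ w [] ys = refl
    sumBy-++ w (x ∷ xs) ys rewrite sumBy-++ w xs ys = sym (+-assoc (w x) (sumBy w xs) (sumBy w ys))

    sumBy-cong : {w v : A → ℕ} (xs : List A) → (∀ a → w a ≡ v a) → sumBy w xs ≡ sumBy v xs
    sumBy-cong [] h = refl
    sumBy-cong (x ∷ xs) h = cong₂ _+_ (h x) (sumBy-cong xs h)

    sumBy-congAll : {w v : A → ℕ} {xs : List A} → All (λ a → w a ≡ v a) xs → sumBy w xs ≡ sumBy v xs
    sumBy-congAll [] = refl
    sumBy-congAll (p ∷ ps) = cong₂ _+_ p (sumBy-congAll ps)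

    sumBy-+ : (w v : A → ℕ) (xs : List A) → sumBy (λ a → w a + v a) xs ≡ sumBy w xs + sumBy v xs
    sumBy-+ w v [] = refl
    sumBy-+ w v (x ∷ xs) rewrite sumBy-+ w v xs = interchange (w x) (v x) (sumBy w xs) (sumBy v xs)

    sumBy-mono : {w v : A → ℕ} (xs : List A) → (∀ a → w a ≤ v a) → sumBy w xs ≤ sumBy v xs
    sumBy-mono [] h = z≤n
    sumBy-mono (x ∷ xs) h = +-mono-≤ (h x) (sumBy-mono xs h)

    sumBy-0 : {w : A → ℕ} (xs : List A) → (∀ a → w a ≡ 0) → sumBy w xs ≡ 0
    sumBy-0 [] h = refl
    sumBy-0 (x ∷ xs) h rewrite h x = sumBy-0 xs h

    sumBy-0All : {w : A → ℕ} {xs : List A} → All (λ a → w a ≡ 0) xs → sumBy w xs ≡ 0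
    sumBy-0All [] = refl
    sumBy-0All (p ∷ ps) rewrite p = sumBy-0All ps

    sumBy-∈ : (w : A → ℕ) {a : A} {xs : List A} → a ∈ xs → w a ≤ sumBy w xs
    sumBy-∈ w {xs = x ∷ xs} (here refl) = m≤m+n (w x) (sumBy w xs)
    sumBy-∈ w {xs = x ∷ xs} (there p) = ≤-trans (sumBy-∈ w p) (m≤n+m (sumBy w xs) (w x))

    sumBy-len : {w : A → ℕ} (xs : List A) → (∀ a → w a ≤ 1) → sumBy w xs ≤ length xs
    sumBy-len [] h = z≤n
    sumBy-len (x ∷ xs) h = +-mono-≤ (h x) (sumBy-len xs h)

    sumBy-len< : {w : A → ℕ} (xs : List A) → (∀ a → w a ≤ 1) → {a : A} → a ∈ xs → w a ≡ 0 → sumBy w xs < length xs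
    sumBy-len< (x ∷ xs) h (here refl) e rewrite e = s≤s (sumBy-len xs h)
    sumBy-len< {w} (x ∷ xs) h (there p) e =
      subst (_≤ suc (length xs)) (+-suc (w x) (sumBy w xs)) (+-mono-≤ (h x) (sumBy-len< xs h p e))

    sumBy-len≥All : {w : A → ℕ} {xs : List A} → All (λ a → 1 ≤ w a) xs → length xs ≤ sumBy w xs
    sumBy-len≥All [] = z≤n
    sumBy-len≥All (p ∷ ps) = +-mono-≤ p (sumBy-len≥All ps)

    sumBy-filter : (w : A → ℕ) (p : A → Bool) (xs : List A) → sumBy w (filterᵇ p xs) ≡ sumBy (λ e → if p e then w e else 0) xs
    sumBy-filter w p [] = refl
    sumBy-filter w p (x ∷ xs) with p x
    ... | true = cong (w x +_) (sumBy-filter w p xs)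
    ... | false = sumBy-filter w p xs

  sumBy-map : ∀ {A B : Set} (w : B → ℕ) (f : A → B) (xs : List A) → sumBy w (map f xs) ≡ sumBy (λ a → w (f a)) xs
  sumBy-map w f [] = refl
  sumBy-map w f (x ∷ xs) = cong (w (f x) +_) (sumBy-map w f xs)

  sum-map≡sumBy : ∀ {A : Set} (w : A → ℕ) (xs : List A) → sum (map w xs) ≡ sumBy w xs
  sum-map≡sumBy w [] = refl
  sum-map≡sumBy w (x ∷ xs) = cong (w x +_) (sum-map≡sumBy w xs)

  sumBy-swap : ∀ {A B : Set} (g : A → B → ℕ) (ks : List A) (es : List B) →
               sumBy (λ k → sumBy (g k) es) ks ≡ sumBy (λ e → sumBy (λ k → g k e) ks) es
  sumBy-swap g [] es = sym (sumBy-0 es (λ _ → refl))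
  sumBy-swap g (k ∷ ks) es rewrite sumBy-swap g ks es = sym (sumBy-+ (g k) (λ e → sumBy (λ k₁ → g k₁ e) ks) es)

  sumBy-cartesianProduct : ∀ {A B : Set} (w : A × B → ℕ) (xs : List A) (ys : List B) →
                           sumBy w (cartesianProduct xs ys) ≡ sumBy (λ i → sumBy (λ j → w (i , j)) ys) xs
  sumBy-cartesianProduct w [] ys = refl
  sumBy-cartesianProduct w (x ∷ xs) ys =
    trans (sumBy-++ w (map (x ,_) ys) _) (cong₂ _+_ (sumBy-map w (x ,_) ys) (sumBy-cartesianProduct w xs ys))

  sumBy-allFin-suc : ∀ {n} (h : Fin (suc n) → ℕ) → sumBy h (allFin (suc n)) ≡ h zero + sumBy (λ i → h (suc i)) (allFin n)
  sumBy-allFin-suc {n} h = cong (h zero +_) (trans (cong (sumBy h) (sym (LP.map-tabulate (λ i → i) suc))) (sumBy-map h suc (allFin n)))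

  sumBy-allFin-single : ∀ {n} (y : Fin n) (g : Fin n → ℕ) → (∀ i → i ≢ y → g i ≡ 0) → sumBy g (allFin n) ≡ g y
  sumBy-allFin-single {suc n} zero g z = begin
    sumBy g (allFin (suc n))                       ≡⟨ sumBy-allFin-suc g ⟩
    g zero + sumBy (λ i → g (suc i)) (allFin n)    ≡⟨ cong (g zero +_) (sumBy-0 (allFin n) (λ i → z (suc i) (λ ()))) ⟩
    g zero + 0                                     ≡⟨ +-identityʳ _ ⟩
    g zero                                         ∎
    where open ≡-Reasoning
  sumBy-allFin-single {suc n} (suc y) g z = begin
    sumBy g (allFin (suc n))                       ≡⟨ sumBy-allFin-suc g ⟩
    g zero + sumBy (λ i → g (suc i)) (allFin n)    ≡⟨ cong (_+ sumBy (λ i → g (suc i)) (allFin n)) (z zero (λ ())) ⟩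
    sumBy (λ i → g (suc i)) (allFin n)             ≡⟨ sumBy-allFin-single y (λ i → g (suc i)) (λ i ne → z (suc i) (ne ∘ FP.suc-injective)) ⟩
    g (suc y)                                      ∎
    where open ≡-Reasoning

  sumBy-allFin-indicator : ∀ {n} (c : Fin n) → sumBy (λ k → ind (does (c FP.≟ k))) (allFin n) ≡ 1
  sumBy-allFin-indicator c = trans (sumBy-allFin-single c _ (λ i ne → cong ind (dec-false (c FP.≟ i) (ne ∘ sym))))
                                   (cong ind (does-refl FP._≟_ c))

  length-allFin : ∀ n → length (allFin n) ≡ n
  length-allFin n = LP.length-tabulate (λ i → i)

module FiniteOrbits where

  open import Data.Nat using (ℕ; zero; suc; _+_; _∸_; _≤_; _<_; z≤n)
  open import Data.Nat.Properties
  open import Data.Fin using (Fin; toℕ)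
  import Data.Fin.Properties as FP
  open import Data.List using (List; _∷_; length)
  open import Data.List.Relation.Unary.Any using (here; there; index)
  open import Data.List.Membership.Propositional using (_∈_)
  open import Data.List.Membership.Setoid.Properties using (index-injective)
  open import Data.Product using (Σ; _×_; _,_)
  open import Data.Sum using (_⊎_; inj₁; inj₂)
  open import Relation.Binary.PropositionalEquality
  open import Relation.Nullary using (yes; no)

  module Orbit {V : Set} (f : V → V) (vs : List V) (moves-into : ∀ z → f z ≡ z ⊎ f z ∈ vs) where

    iter : ℕ → V → V
    iter zero z = z
    iter (suc k) z = iter k (f z)

    iter-suc : ∀ k z → iter (suc k) z ≡ f (iter k z)
    iter-suc zero z = refl
    iter-suc (suc k) z = iter-suc k (f z)

    iter-+ : ∀ m n z → iter (m + n) z ≡ iter n (iter m z)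
    iter-+ zero n z = refl
    iter-+ (suc m) n z = iter-+ m n (f z)

    iter-fix : ∀ {w} → f w ≡ w → ∀ k → iter k w ≡ w
    iter-fix p zero = refl
    iter-fix {w} p (suc k) rewrite p = iter-fix p k

    iter-∈ : ∀ i z → iter i z ∈ (z ∷ vs)
    iter-∈ zero z = here refl
    iter-∈ (suc i) z rewrite iter-suc i z with moves-into (iter i z)
    ... | inj₁ e rewrite e = iter-∈ i z
    ... | inj₂ m = there m

    B : ℕ
    B = suc (suc (length vs))

    -- Among the B points iter 0 z, …, iter (B - 1) z ∈ z ∷ vs two coincide, so the
    -- orbit repeats and any iterate beyond B is already an earlier one.
    iter-shortcut : ∀ k z → B ≤ k → Σ ℕ λ k' → k' < k × iter k' z ≡ iter k z
    iter-shortcut k z B≤k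
      with FP.pigeonhole (n<1+n (suc (length vs))) (λ (i : Fin B) → index (iter-∈ (toℕ i) z))
    ... | i , j , i<j , eq = (k ∸ toℕ j) + toℕ i , k'<k , iter-k'≡iter-k
      where
      j≤k : toℕ j ≤ k
      j≤k = ≤-trans (<⇒≤ (FP.toℕ<n j)) B≤k

      k'<k : (k ∸ toℕ j) + toℕ i < k
      k'<k = begin-strict
        (k ∸ toℕ j) + toℕ i  <⟨ +-monoʳ-< (k ∸ toℕ j) i<j ⟩
        (k ∸ toℕ j) + toℕ j  ≡⟨ m∸n+n≡m j≤k ⟩
        k                    ∎
        where open ≤-Reasoning

      iter-k'≡iter-k : iter ((k ∸ toℕ j) + toℕ i) z ≡ iter k z
      iter-k'≡iter-k = begin
        iter ((k ∸ toℕ j) + toℕ i) z     ≡⟨ cong (λ h → iter h z) (+-comm (k ∸ toℕ j) (toℕ i)) ⟩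
        iter (toℕ i + (k ∸ toℕ j)) z     ≡⟨ iter-+ (toℕ i) (k ∸ toℕ j) z ⟩
        iter (k ∸ toℕ j) (iter (toℕ i) z) ≡⟨ cong (iter (k ∸ toℕ j)) (index-injective (setoid V) (iter-∈ (toℕ i) z) (iter-∈ (toℕ j) z) eq) ⟩
        iter (k ∸ toℕ j) (iter (toℕ j) z) ≡⟨ iter-+ (toℕ j) (k ∸ toℕ j) z ⟨
        iter (toℕ j + (k ∸ toℕ j)) z     ≡⟨ cong (λ h → iter h z) (m+[n∸m]≡n j≤k) ⟩
        iter k z                         ∎
        where open ≡-Reasoning

    module _ {w : V} (fw : f w ≡ w) where
      reach-fixpoint-within : ∀ k z → k ≤ B → iter k z ≡ w → iter B z ≡ w
      reach-fixpoint-within k z k≤B e = begin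
        iter B z                 ≡⟨ cong (λ h → iter h z) (m+[n∸m]≡n k≤B) ⟨
        iter (k + (B ∸ k)) z     ≡⟨ iter-+ k (B ∸ k) z ⟩
        iter (B ∸ k) (iter k z)  ≡⟨ cong (iter (B ∸ k)) e ⟩
        iter (B ∸ k) w           ≡⟨ iter-fix fw (B ∸ k) ⟩
        w                        ∎
        where open ≡-Reasoning

      reach-fixpoint-fuel : ∀ fuel k z → k ≤ fuel → iter k z ≡ w → iter B z ≡ w
      reach-fixpoint-fuel zero .zero z z≤n e = reach-fixpoint-within 0 z z≤n e
      reach-fixpoint-fuel (suc fuel) k z k≤ e with k ≤? B
      ... | yes k≤B = reach-fixpoint-within k z k≤B e
      ... | no k≰B with iter-shortcut k z (<⇒≤ (≰⇒> k≰B))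
      ...   | k' , k'<k , e' = reach-fixpoint-fuel fuel k' z (≤-pred (≤-trans k'<k k≤)) (trans e' e)

      reach-fixpoint : ∀ k z → iter k z ≡ w → iter B z ≡ w
      reach-fixpoint k z = reach-fixpoint-fuel k k z ≤-refl

module Blocks where

  open Sums
  open import Data.Nat using (ℕ; zero; suc; _+_; _*_; _∸_; _≤_; _<_; z≤n; s≤s; _⊓_; _≟_; _<?_)
  open import Data.Nat.Properties
  open import Data.Nat.DivMod
  open import Data.Bool using (Bool; true; false; _∧_)
  open import Data.Bool.Properties using (∧-zeroʳ)
  open import Data.List using (List)
  open import Data.Empty using (⊥-elim)
  open import Relation.Nullary using (yes; no; does)
  open import Relation.Nullary.Decidable using (dec-true; dec-false)
  open import Relation.Binary.PropositionalEquality
  open import Relation.Binary.Definitions using (tri<; tri≈; tri>)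

  module BlockCount (x' : ℕ) where
    x : ℕ
    x = suc x'

    blockCount : ℕ → ℕ → ℕ
    blockCount m zero = 0
    blockCount m (suc D) = ind (does (D / x ≟ m)) + blockCount m D

    <suc-quotient* : ∀ D → D < suc (D / x) * x
    <suc-quotient* D = begin-strict
      D ≡⟨ m≡m%n+[m/n]*n D x ⟩
      D % x + (D / x) * x <⟨ +-monoˡ-< ((D / x) * x) (m%n<n D x) ⟩
      x + (D / x) * x ≡⟨⟩
      suc (D / x) * x ∎
      where open ≤-Reasoning

    rem< : ∀ D → D ∸ (D / x) * x < x
    rem< D = subst (_< x) (m%n≡m∸m/n*n D x) (m%n<n D x)

    blockCount-formula : ∀ m D → blockCount m D ≡ (D ∸ m * x) ⊓ x
    blockCount-formula m zero = sym (cong (_⊓ x) (0∸n≡0 (m * x)))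
    blockCount-formula m (suc D) with D / x ≟ m
    ... | yes e rewrite sym e | does-refl _≟_ (D / x) = begin
          1 + blockCount (D / x) D ≡⟨ cong suc (blockCount-formula (D / x) D) ⟩
          suc ((D ∸ (D / x) * x) ⊓ x) ≡⟨ cong suc (m≤n⇒m⊓n≡m (<⇒≤ a)) ⟩
          suc (D ∸ (D / x) * x) ≡⟨ sym (m≤n⇒m⊓n≡m a) ⟩
          suc (D ∸ (D / x) * x) ⊓ x ≡⟨ cong (_⊓ x) (sym (+-∸-assoc 1 (m/n*n≤m D x))) ⟩
          (suc D ∸ (D / x) * x) ⊓ x ∎
      where
      open ≡-Reasoning
      a : D ∸ (D / x) * x < x
      a = rem< D
    ... | no ne rewrite does-no _≟_ ne with <-cmp (D / x) m
    ...   | tri≈ _ e _ = ⊥-elim (ne e)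
    ...   | tri< l _ _ = begin
            0 + blockCount m D ≡⟨ blockCount-formula m D ⟩
            (D ∸ m * x) ⊓ x ≡⟨ cong (_⊓ x) (m≤n⇒m∸n≡0 (<⇒≤ b)) ⟩
            0 ⊓ x ≡⟨ cong (_⊓ x) (sym (m≤n⇒m∸n≡0 b)) ⟩
            (suc D ∸ m * x) ⊓ x ∎
      where
      open ≡-Reasoning
      b : suc D ≤ m * x
      b = ≤-trans (<suc-quotient* D) (*-monoˡ-≤ x l)
    ...   | tri> _ _ g = begin
            0 + blockCount m D ≡⟨ blockCount-formula m D ⟩
            (D ∸ m * x) ⊓ x ≡⟨ m≥n⇒m⊓n≡n c1 ⟩
            x ≡⟨ sym (m≥n⇒m⊓n≡n c2) ⟩
            (suc D ∸ m * x) ⊓ x ∎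
      where
      open ≡-Reasoning
      c0 : suc m * x ≤ D
      c0 = ≤-trans (*-monoˡ-≤ x g) (m/n*n≤m D x)
      c1 : x ≤ D ∸ m * x
      c1 = subst (_≤ D ∸ m * x) (m+n∸n≡m x (m * x)) (∸-monoˡ-≤ (m * x) c0)
      c2 : x ≤ suc D ∸ m * x
      c2 = ≤-trans c1 (∸-monoˡ-≤ (m * x) (n≤1+n D))

    blockCount≤ : ∀ m D → blockCount m D ≤ x
    blockCount≤ m D rewrite blockCount-formula m D = m⊓n≤n (D ∸ m * x) x

    blockCount-full : ∀ m D → suc m * x ≤ D → blockCount m D ≡ x
    blockCount-full m D le rewrite blockCount-formula m D = m≥n⇒m⊓n≡n (subst (_≤ D ∸ m * x) (m+n∸n≡m x (m * x)) (∸-monoˡ-≤ (m * x) le))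

  sumBelow : ℕ → (ℕ → ℕ) → ℕ
  sumBelow zero g = 0
  sumBelow (suc M) g = sumBelow M g + g M

  sumBelow-mono : ∀ M (g h : ℕ → ℕ) → (∀ m → m < M → g m ≤ h m) → sumBelow M g ≤ sumBelow M h
  sumBelow-mono zero g h p = z≤n
  sumBelow-mono (suc M) g h p = +-mono-≤ (sumBelow-mono M g h (λ m lt → p m (m<n⇒m<1+n lt))) (p M (n<1+n M))

  sumBelow-ones : ∀ M → sumBelow M (λ _ → 1) ≡ M
  sumBelow-ones zero = refl
  sumBelow-ones (suc M) = trans (+-comm (sumBelow M (λ _ → 1)) 1) (cong suc (sumBelow-ones M))

  ind-<-suc : ∀ i M → ind (does (i <? suc M)) ≡ ind (does (i <? M)) + ind (does (i ≟ M))
  ind-<-suc i M with <-cmp i M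
  ... | tri< l _ _ rewrite dec-true (i <? suc M) (m<n⇒m<1+n l) | dec-true (i <? M) l | dec-false (i ≟ M) (<⇒≢ l) = refl
  ... | tri≈ _ refl _ rewrite dec-true (i <? suc i) (n<1+n i) | dec-false (i <? i) (n≮n i) | dec-true (i ≟ i) refl = refl
  ... | tri> _ _ g rewrite dec-false (i <? suc M) (λ l → <-irrefl refl (≤-trans (s≤s g) l))
                        | dec-false (i <? M) (λ l → <-asym l g) | dec-false (i ≟ M) (λ e → >⇒≢ g e) = refl

  sum-below-by-blocks : ∀ {A : Set} (X : A → Bool) (idx : A → ℕ) M (xs : List A) →
             sumBy (λ a → ind (X a ∧ does (idx a <? M))) xs ≡ sumBelow M (λ m → sumBy (λ a → ind (X a ∧ does (idx a ≟ m))) xs)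
  sum-below-by-blocks X idx zero xs = sumBy-0 xs pt
    where
    pt : ∀ a → ind (X a ∧ does (idx a <? 0)) ≡ 0
    pt a rewrite dec-false (idx a <? 0) (λ ()) | ∧-zeroʳ (X a) = refl
  sum-below-by-blocks X idx (suc M) xs =
    trans (sumBy-cong xs pt) (trans (sumBy-+ _ _ xs) (cong (_+ inBlock M) (sum-below-by-blocks X idx M xs)))
    where
    inBlock : ℕ → ℕ
    inBlock m = sumBy (λ a → ind (X a ∧ does (idx a ≟ m))) xs
    pt : ∀ a → ind (X a ∧ does (idx a <? suc M)) ≡ ind (X a ∧ does (idx a <? M)) + ind (X a ∧ does (idx a ≟ M))
    pt a with X a
    ... | true = ind-<-suc (idx a) M
    ... | false = refl

module BipartiteEdgeColouring where

  open Sums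
  open FiniteOrbits
  open import Data.Nat using (ℕ; zero; suc; _+_; _≤_; _<_; z≤n; s≤s)
  open import Data.Nat.Properties
  open import Data.Fin using (Fin; zero; suc)
  import Data.Fin.Properties as FP
  open import Data.Bool using (Bool; true; false; _∧_; _∨_; if_then_else_)
  open import Data.Bool.Properties using (∨-zeroʳ)
  open import Data.List using (List; []; _∷_; length; allFin)
  open import Data.List.Relation.Unary.All using (All; []; _∷_)
  import Data.List.Relation.Unary.All as All
  open import Data.List.Relation.Unary.All.Properties using (¬Any⇒All¬)
  open import Data.List.Relation.Unary.Any using (here; there; any?; satisfied)
  open import Data.List.Membership.Propositional using (_∈_)
  open import Data.List.Relation.Unary.Unique.Propositional using (Unique)
  open import Data.List.Relation.Unary.AllPairs using ([]; _∷_)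
  open import Data.Product using (Σ; _×_; _,_; proj₁; proj₂)
  open import Data.Sum using (_⊎_; inj₁; inj₂)
  open import Data.Empty using (⊥-elim)
  open import Relation.Nullary using (Dec; yes; no; does)
  open import Relation.Binary.PropositionalEquality
  open import Relation.Binary.Definitions using (DecidableEquality)

  module EdgeColouring {V E : Set} (_≟V_ : DecidableEquality V) (_≟E_ : DecidableEquality E)
    (lft rgt : E → V) (side : V → Bool) (x' : ℕ) where

    C : Set
    C = Fin (suc x')

    _==_ : C → C → Bool
    a == b = does (a FP.≟ b)

    incident : V → E → Bool
    incident z e = does (lft e ≟V z) ∨ does (rgt e ≟V z)

    deg : V → List E → ℕ
    deg z = sumBy (λ e → ind (incident z e))

    colourDeg : (E → C) → V → C → List E → ℕ
    colourDeg col z k = sumBy (λ e → ind (incident z e ∧ (col e == k)))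

    Proper : (E → C) → List E → Set
    Proper col es = ∀ z k → colourDeg col z k es ≤ 1

    LeftToRight : E → Set
    LeftToRight e = side (lft e) ≡ false × side (rgt e) ≡ true

    incident-cases : ∀ z e → incident z e ≡ true → lft e ≡ z ⊎ rgt e ≡ z
    incident-cases z e h with lft e ≟V z | rgt e ≟V z
    ... | yes p | _ = inj₁ p
    ... | no _ | yes q = inj₂ q
    incident-cases z e () | no _ | no _

    colour-counts-sum : ∀ col z es → sumBy (λ k → colourDeg col z k es) (allFin (suc x')) ≡ deg z es
    colour-counts-sum col z es = trans (sumBy-swap (λ k e → ind (incident z e ∧ (col e == k))) (allFin (suc x')) es)
                              (sumBy-cong es pt)
      where
      pt : ∀ e → sumBy (λ k → ind (incident z e ∧ (col e == k))) (allFin (suc x')) ≡ ind (incident z e)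
      pt e with incident z e
      ... | true = sumBy-allFin-indicator (col e)
      ... | false = sumBy-0 (allFin (suc x')) (λ _ → refl)

    missing-colour : ∀ col z es → deg z es < suc x' → Σ C λ k → colourDeg col z k es ≡ 0
    missing-colour col z es lt with any? (λ k → colourDeg col z k es ≟ 0) (allFin (suc x'))
    ... | yes p = satisfied p
    ... | no ¬p = ⊥-elim (<⇒≱ lt (begin
          suc x' ≡⟨ sym (length-allFin (suc x')) ⟩
          length (allFin (suc x')) ≤⟨ sumBy-len≥All (All.map (λ ne → n≢0⇒n>0 ne) (¬Any⇒All¬ _ ¬p)) ⟩
          sumBy (λ k → colourDeg col z k es) (allFin (suc x')) ≡⟨ colour-counts-sum col z es ⟩
          deg z es ∎))
      where open ≤-Reasoning

    -- step z crosses the edge at z coloured α (z on the left) or β (z on the right); iterating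
    -- it walks the α/β-alternating path from z, which stops where that colour is missing.
    module Kempe (col : E → C) (α β : C) (es : List E) where
      chainEdge : V → E → Bool
      chainEdge z e = if side z then (does (rgt e ≟V z) ∧ (col e == β)) else (does (lft e ≟V z) ∧ (col e == α))

      across : V → E → V
      across z e = if side z then lft e else rgt e

      chainColour : V → C
      chainColour z = if side z then β else α

      follow : V → List E → V
      follow z [] = z
      follow z (e ∷ fs) = if chainEdge z e then across z e else follow z fs

      chainEdge-incident : ∀ z e → chainEdge z e ≡ true → incident z e ∧ (col e == chainColour z) ≡ true
      chainEdge-incident z e h with side z
      ... | true with rgt e ≟V z | col e FP.≟ β
      ...   | yes _ | yes _ = cong (_∧ true) (∨-zeroʳ (does (lft e ≟V z)))
      chainEdge-incident z e () | true | no _ | _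
      chainEdge-incident z e () | true | yes _ | no _
      chainEdge-incident z e h | false with lft e ≟V z | col e FP.≟ α
      ...   | yes _ | yes _ = refl
      chainEdge-incident z e () | false | no _ | _
      chainEdge-incident z e () | false | yes _ | no _

      follow-chainEdge : ∀ fs z e → e ∈ fs → chainEdge z e ≡ true → colourDeg col z (chainColour z) fs ≤ 1 → follow z fs ≡ across z e
      follow-chainEdge (e ∷ fs) z .e (here refl) h c rewrite h = refl
      follow-chainEdge (e' ∷ fs) z e (there p) h c with chainEdge z e' in eq
      ... | true = ⊥-elim (<⇒≱ (≤-trans (s≤s e-in-fs) (≤-reflexive (sym e'-counts))) c)
        where
        e-in-fs : 1 ≤ colourDeg col z (chainColour z) fs
        e-in-fs = subst (_≤ colourDeg col z (chainColour z) fs) (cong ind (chainEdge-incident z e h))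
                        (sumBy-∈ (λ e → ind (incident z e ∧ (col e == chainColour z))) p)
        e'-counts : colourDeg col z (chainColour z) (e' ∷ fs) ≡ suc (colourDeg col z (chainColour z) fs)
        e'-counts = cong (_+ colourDeg col z (chainColour z) fs) (cong ind (chainEdge-incident z e' eq))
      ... | false = follow-chainEdge fs z e p h (≤-trans (m≤n+m _ (ind (incident z e' ∧ (col e' == chainColour z)))) c)

      follow-stuck : ∀ fs z → colourDeg col z (chainColour z) fs ≡ 0 → follow z fs ≡ z
      follow-stuck [] z h = refl
      follow-stuck (e ∷ fs) z h with chainEdge z e in eq
      ... | true = ⊥-elim (1+n≢0 (trans (cong (_+ colourDeg col z (chainColour z) fs) (sym (cong ind (chainEdge-incident z e eq)))) h))
      ... | false = follow-stuck fs z (m+n≡0⇒n≡0 (ind (incident z e ∧ (col e == chainColour z))) h)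

      ends : List E → List V
      ends [] = []
      ends (e ∷ fs) = lft e ∷ rgt e ∷ ends fs

      follow-moves : ∀ fs z → follow z fs ≡ z ⊎ follow z fs ∈ ends fs
      follow-moves [] z = inj₁ refl
      follow-moves (e ∷ fs) z with chainEdge z e
      ... | true = inj₂ (across-∈ (side z))
        where
        across-∈ : ∀ b → (if b then lft e else rgt e) ∈ (lft e ∷ rgt e ∷ ends fs)
        across-∈ true = here refl
        across-∈ false = there (here refl)
      ... | false with follow-moves fs z
      ...   | inj₁ p = inj₁ p
      ...   | inj₂ m = inj₂ (there (there m))

      step : V → V
      step z = follow z es

      open Orbit step (ends es) (λ z → follow-moves es z) public

      swapαβ : C → C
      swapαβ c = if does (c FP.≟ α) then β else (if does (c FP.≟ β) then α else c)

      swapαβ-α : swapαβ α ≡ β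
      swapαβ-α rewrite does-refl FP._≟_ α = refl

      swapαβ-β : swapαβ β ≡ α
      swapαβ-β with β FP.≟ α
      ... | yes p = p
      ... | no _ rewrite does-refl FP._≟_ β = refl

      swapαβ-other : ∀ {c} → c ≢ α → c ≢ β → swapαβ c ≡ c
      swapαβ-other {c} p q rewrite does-no FP._≟_ p | does-no FP._≟_ q = refl

      swapαβ-involutive : ∀ c → swapαβ (swapαβ c) ≡ c
      swapαβ-involutive c = aux (c FP.≟ α) (c FP.≟ β)
        where
        aux : Dec (c ≡ α) → Dec (c ≡ β) → swapαβ (swapαβ c) ≡ c
        aux (yes p) _ = subst (λ h → swapαβ (swapαβ h) ≡ h) (sym p) (trans (cong swapαβ swapαβ-α) swapαβ-β)
        aux (no _) (yes q) = subst (λ h → swapαβ (swapαβ h) ≡ h) (sym q) (trans (cong swapαβ swapαβ-β) swapαβ-α)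
        aux (no p) (no q) = trans (cong swapαβ (swapαβ-other p q)) (swapαβ-other p q)

      does-involution : (g : C → C) → (∀ c → g (g c) ≡ c) → ∀ c d → does (g c FP.≟ d) ≡ does (c FP.≟ g d)
      does-involution g gi c d with g c FP.≟ d | c FP.≟ g d
      ... | yes _ | yes _ = refl
      ... | no _ | no _ = refl
      ... | yes p | no q = ⊥-elim (q (trans (sym (gi c)) (cong g p)))
      ... | no p | yes q = ⊥-elim (p (trans (cong g q) (gi d)))

      module Swap (proper : Proper col es) (sides : All LeftToRight es) (u w : V)
                  (uL : side u ≡ false) (wR : side w ≡ true)
                  (uα : colourDeg col u α es ≡ 0) (wβ : colourDeg col w β es ≡ 0) where

        step-w : step w ≡ w
        step-w = follow-stuck es w (subst (λ b → colourDeg col w (if b then β else α) es ≡ 0) (sym wR) wβ)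

        step-u : step u ≡ u
        step-u = follow-stuck es u (subst (λ b → colourDeg col u (if b then β else α) es ≡ 0) (sym uL) uα)

        -- onChain z: the alternating path from z ends at w. Swapping α and β on this chain keeps
        -- the colouring proper and frees α at w, while u, a fixed point of step other than w, keeps α free.
        onChain : V → Bool
        onChain z = does (iter B z ≟V w)

        onChain-w : onChain w ≡ true
        onChain-w rewrite iter-fix step-w B = does-refl _≟V_ w

        u≢w : u ≢ w
        u≢w e with trans (sym wR) (trans (cong side (sym e)) uL)
        ... | ()

        onChain-u : onChain u ≡ false
        onChain-u rewrite iter-fix step-u B = does-no _≟V_ u≢w

        onChain-step : ∀ a b → step a ≡ b → onChain a ≡ onChain b
        onChain-step a b fab with iter B a ≟V w | iter B b ≟V w
        ... | yes _ | yes _ = refl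
        ... | no _ | no _ = refl
        ... | yes p | no q = ⊥-elim (q (begin
              iter (suc (suc (length (ends es)))) b ≡⟨ iter-suc (suc (length (ends es))) b ⟩
              step (iter (suc (length (ends es))) b) ≡⟨ cong (λ h → step (iter (suc (length (ends es))) h)) (sym fab) ⟩
              step (iter (suc (suc (length (ends es)))) a) ≡⟨ cong step p ⟩
              step w ≡⟨ step-w ⟩
              w ∎))
          where open ≡-Reasoning
        ... | no p | yes q = ⊥-elim (p (reach-fixpoint step-w (suc B) a (trans (cong (iter B) fab) q)))

        step-α : ∀ e → e ∈ es → col e ≡ α → step (lft e) ≡ rgt e
        step-α e m ce = trans (follow-chainEdge es (lft e) e m chainEdge-e (proper (lft e) _)) across-e
          where
          chainEdge-e : chainEdge (lft e) e ≡ true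
          chainEdge-e rewrite proj₁ (All.lookup sides m) | does-refl _≟V_ (lft e) | ce = does-refl FP._≟_ α
          across-e : across (lft e) e ≡ rgt e
          across-e rewrite proj₁ (All.lookup sides m) = refl

        step-β : ∀ e → e ∈ es → col e ≡ β → step (rgt e) ≡ lft e
        step-β e m ce = trans (follow-chainEdge es (rgt e) e m chainEdge-e (proper (rgt e) _)) across-e
          where
          chainEdge-e : chainEdge (rgt e) e ≡ true
          chainEdge-e rewrite proj₂ (All.lookup sides m) | does-refl _≟V_ (rgt e) | ce = does-refl FP._≟_ β
          across-e : across (rgt e) e ≡ lft e
          across-e rewrite proj₂ (All.lookup sides m) = refl

        swapped : E → C
        swapped e = if onChain (lft e) then swapαβ (col e) else col e

        swapAt : V → C → C
        swapAt z c = if onChain z then swapαβ c else c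

        swapAt-involutive : ∀ z c → swapAt z (swapAt z c) ≡ c
        swapAt-involutive z c with onChain z
        ... | true = swapαβ-involutive c
        ... | false = refl

        swapped-at : ∀ z e → e ∈ es → incident z e ≡ true → swapped e ≡ swapAt z (col e)
        swapped-at z e m a with incident-cases z e a
        ... | inj₁ refl = refl
        ... | inj₂ refl = aux (col e FP.≟ α) (col e FP.≟ β)
          where
          if-same : ∀ (b : Bool) (c : C) → (if b then c else c) ≡ c
          if-same true c = refl
          if-same false c = refl
          aux : Dec (col e ≡ α) → Dec (col e ≡ β) → swapped e ≡ swapAt (rgt e) (col e)
          aux (yes ca) _ = cong (λ b → if b then swapαβ (col e) else col e) (onChain-step (lft e) (rgt e) (step-α e m ca))
          aux (no _) (yes cb) = cong (λ b → if b then swapαβ (col e) else col e) (sym (onChain-step (rgt e) (lft e) (step-β e m cb)))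
          aux (no p) (no q) = trans (cong (λ h → if onChain (lft e) then h else col e) (swapαβ-other p q))
                                (trans (if-same (onChain (lft e)) (col e))
                                  (sym (trans (cong (λ h → if onChain (rgt e) then h else col e) (swapαβ-other p q)) (if-same (onChain (rgt e)) (col e)))))

        colourDeg-swapped : ∀ z k → colourDeg swapped z k es ≡ colourDeg col z (swapAt z k) es
        colourDeg-swapped z k = sumBy-congAll (All.tabulate pt)
          where
          pt : ∀ {e} → e ∈ es → ind (incident z e ∧ (swapped e == k)) ≡ ind (incident z e ∧ (col e == swapAt z k))
          pt {e} m with incident z e in a
          ... | false = refl
          ... | true rewrite swapped-at z e m a = cong ind (does-involution (swapAt z) (swapAt-involutive z) (col e) k)

        swapped-proper : Proper swapped es
        swapped-proper z k rewrite colourDeg-swapped z k = proper z (swapAt z k)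

        α-missing-at-w : colourDeg swapped w α es ≡ 0
        α-missing-at-w rewrite colourDeg-swapped w α | onChain-w | swapαβ-α = wβ

        α-missing-at-u : colourDeg swapped u α es ≡ 0
        α-missing-at-u rewrite colourDeg-swapped u α | onChain-u = uα

    konig : ∀ es → All LeftToRight es → Unique es → (∀ z → deg z es ≤ suc x') → Σ (E → C) (λ col → Proper col es)
    konig [] _ _ _ = (λ _ → zero) , (λ z k → z≤n)
    konig (e0 ∷ rest) (s0 ∷ ss) (h ∷ un) dg = extended , extended-proper
      where
      coloured : Σ (E → C) (λ col → Proper col rest)
      coloured = konig rest ss un (λ z → ≤-trans (m≤n+m _ (ind (incident z e0))) (dg z))
      col : E → C
      col = proj₁ coloured
      u w : V
      u = lft e0
      w = rgt e0
      deg-u< : deg u rest < suc x'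
      deg-u< = subst (λ b → ind (b ∨ does (rgt e0 ≟V u)) + deg u rest ≤ suc x') (does-refl _≟V_ u) (dg u)
      deg-w< : deg w rest < suc x'
      deg-w< = subst (λ b → ind b + deg w rest ≤ suc x') (trans (cong (does (lft e0 ≟V w) ∨_) (does-refl _≟V_ w)) (∨-zeroʳ _)) (dg w)
      α β : C
      α = proj₁ (missing-colour col u rest deg-u<)
      β = proj₁ (missing-colour col w rest deg-w<)
      open Kempe col α β rest
      open Swap (proj₂ coloured) ss u w (proj₁ s0) (proj₂ s0) (proj₂ (missing-colour col u rest deg-u<)) (proj₂ (missing-colour col w rest deg-w<))
      extended : E → C
      extended e = if does (e ≟E e0) then α else swapped e
      colourDeg-extended-rest : ∀ z k → colourDeg extended z k rest ≡ colourDeg swapped z k rest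
      colourDeg-extended-rest z k = sumBy-congAll (All.map pt h)
        where
        pt : ∀ {e} → e0 ≢ e → ind (incident z e ∧ (extended e == k)) ≡ ind (incident z e ∧ (swapped e == k))
        pt {e} ne rewrite does-no _≟E_ (λ p → ne (sym p)) = refl
      extended-proper : Proper extended (e0 ∷ rest)
      extended-proper z k rewrite colourDeg-extended-rest z k | does-refl _≟E_ e0 with incident z e0 in a | α FP.≟ k
      ... | false | _ = swapped-proper z k
      ... | true | no _ = swapped-proper z k
      ... | true | yes refl with incident-cases z e0 a
      ...   | inj₁ refl rewrite α-missing-at-u = s≤s z≤n
      ...   | inj₂ refl rewrite α-missing-at-w = s≤s z≤n

module BalancedOrientation where

  open Sums
  open import Data.Nat using (ℕ; suc; _+_; _≤_; z≤n; s≤s)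
  open import Data.Nat.Properties
  open import Data.Bool using (Bool; true; false; if_then_else_; not)
  open import Data.List using (List; []; _∷_; map; _++_; length)
  import Data.List.Properties as LP
  open import Data.List.Relation.Unary.All using (All; []; _∷_)
  import Data.List.Relation.Unary.All as All
  open import Data.List.Relation.Unary.Any using (Any; here; there; any?)
  import Data.List.Relation.Unary.Any as Any
  open import Data.List.Membership.Propositional using (_∈_)
  open import Data.List.Membership.Propositional.Properties using (∈-map⁺)
  open import Data.Product using (Σ; _×_; _,_; proj₁; proj₂)
  open import Relation.Nullary using (¬_; Dec; yes; no; does)
  open import Relation.Binary.PropositionalEquality
  open import Relation.Binary.Definitions using (DecidableEquality)
  open import Function using (_∘_)
  open import Data.Nat.Tactic.RingSolver using (solve-∀)

  regroup₁ : ∀ a b P Q → a + (P + (b + Q)) ≡ b + (a + (P + Q))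
  regroup₁ = solve-∀

  regroup₂ : ∀ a b P Q → a + (P + (b + Q)) ≡ a + (b + (P + Q))
  regroup₂ = solve-∀

  splitAny : ∀ {A : Set} {P : A → Set} {xs : List A} → Any P xs →
             Σ (List A) λ pre → Σ (List A) λ post → Σ A λ e → xs ≡ pre ++ e ∷ post × P e
  splitAny {xs = x ∷ xs} (here p) = [] , xs , x , refl , p
  splitAny {xs = x ∷ xs} (there a) with splitAny a
  ... | pre , post , e , eq , p = x ∷ pre , post , e , cong (x ∷_) eq , p

  map-++-inv : ∀ {A B : Set} (f : A → B) (xs : List A) (ys zs : List B) → map f xs ≡ ys ++ zs →
               Σ (List A) λ xs1 → Σ (List A) λ xs2 → xs ≡ xs1 ++ xs2 × map f xs1 ≡ ys × map f xs2 ≡ zs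
  map-++-inv f xs [] zs eq = [] , xs , refl , refl , eq
  map-++-inv f (x ∷ xs) (y ∷ ys) zs eq with map-++-inv f xs ys zs (LP.∷-injectiveʳ eq)
  ... | xs1 , xs2 , e1 , e2 , e3 = x ∷ xs1 , xs2 , cong (x ∷_) e1 , cong₂ _∷_ (LP.∷-injectiveˡ eq) e2 , e3

  module OrientedEdges {V : Set} (_≟_ : DecidableEquality V) where

    tl : V × V → Bool → V
    tl (a , b) f = if f then b else a

    hd : V × V → Bool → V
    hd (a , b) f = if f then a else b

    tl-not : ∀ e f → tl e (not f) ≡ hd e f
    tl-not e true = refl
    tl-not e false = refl

    hd-not : ∀ e f → hd e (not f) ≡ tl e f
    hd-not e true = refl
    hd-not e false = refl

    Arc : Set
    Arc = (V × V) × Bool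

    edgeOf : Arc → V × V
    edgeOf = proj₁

    tail head : Arc → V
    tail (e , r) = tl e r
    head (e , r) = hd e r

    outdeg indeg : V → List Arc → ℕ
    outdeg y = sumBy (λ o → ind (does (tail o ≟ y)))
    indeg y = sumBy (λ o → ind (does (head o ≟ y)))

    Balanced : List Arc → Set
    Balanced OL = ∀ y → outdeg y OL ≤ suc (indeg y OL) × indeg y OL ≤ suc (outdeg y OL)

    Shares : V × V → V × V → Set
    Shares e1 e2 = Σ Bool λ f1 → Σ Bool λ f2 → hd e1 f1 ≡ tl e2 f2

    shares? : ∀ e1 e2 → Dec (Shares e1 e2)
    shares? e1 e2 with hd e1 false ≟ tl e2 false
    ... | yes p = yes (false , false , p)
    ... | no n1 with hd e1 false ≟ tl e2 true
    ... | yes p = yes (false , true , p)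
    ... | no n2 with hd e1 true ≟ tl e2 false
    ... | yes p = yes (true , false , p)
    ... | no n3 with hd e1 true ≟ tl e2 true
    ... | yes p = yes (true , true , p)
    ... | no n4 = no λ { (false , false , p) → n1 p ; (false , true , p) → n2 p ; (true , false , p) → n3 p ; (true , true , p) → n4 p }

    sumBy-shift : ∀ (g : Arc → ℕ) (o1 o2 : Arc) (P Q : List Arc) →
              sumBy g (o1 ∷ P ++ o2 ∷ Q) ≡ g o1 + (sumBy g P + (g o2 + sumBy g Q))
    sumBy-shift g o1 o2 P Q = cong (g o1 +_) (sumBy-++ g P (o2 ∷ Q))

    sumBy-shift' : ∀ (g : Arc → ℕ) (o : Arc) (P Q : List Arc) →
              sumBy g (o ∷ P ++ Q) ≡ g o + (sumBy g P + sumBy g Q)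
    sumBy-shift' g o P Q = cong (g o +_) (sumBy-++ g P Q)

    balanced-+ : ∀ {o' i' o i} v → o ≡ v + o' → i ≡ v + i' → o' ≤ suc i' × i' ≤ suc o' → o ≤ suc i × i ≤ suc o
    balanced-+ {o'} {i'} v refl refl (p , q) =
      subst (v + o' ≤_) (+-suc v i') (+-monoʳ-≤ v p) , subst (v + i' ≤_) (+-suc v o') (+-monoʳ-≤ v q)

    Orientation : List (V × V) → Set
    Orientation E = Σ (List Arc) λ OL → map edgeOf OL ≡ E × Balanced OL

    -- Orient the shortcut u–w of the path u–v–w and route it through v: v gains one
    -- in- and one out-arc, every other vertex keeps its counts.
    module Splice (e1 e2 : V × V) (f1 f2 : Bool) (joint : hd e1 f1 ≡ tl e2 f2) where
      u v w : V
      u = tl e1 f1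
      v = hd e1 f1
      w = hd e2 f2

      shortcut : V × V
      shortcut = u , w

      flipIf : Bool → Bool → Bool
      flipIf β f = if β then not f else f

      routed : Bool → List Arc → List Arc → List Arc
      routed β P Q = (e1 , flipIf β f1) ∷ P ++ (e2 , flipIf β f2) ∷ Q

      outdeg-routed : ∀ β P Q y → outdeg y (routed β P Q) ≡ ind (does (v ≟ y)) + outdeg y ((shortcut , β) ∷ P ++ Q)
      outdeg-routed false P Q y
        rewrite sumBy-shift (λ o → ind (does (tail o ≟ y))) (e1 , f1) (e2 , f2) P Q
              | sumBy-shift' (λ o → ind (does (tail o ≟ y))) (shortcut , false) P Q
              | sym joint = regroup₁ (ind (does (u ≟ y))) (ind (does (v ≟ y))) (outdeg y P) (outdeg y Q)
      outdeg-routed true P Q y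
        rewrite sumBy-shift (λ o → ind (does (tail o ≟ y))) (e1 , not f1) (e2 , not f2) P Q
              | sumBy-shift' (λ o → ind (does (tail o ≟ y))) (shortcut , true) P Q
              | tl-not e1 f1 | tl-not e2 f2 = regroup₂ (ind (does (v ≟ y))) (ind (does (w ≟ y))) (outdeg y P) (outdeg y Q)

      indeg-routed : ∀ β P Q y → indeg y (routed β P Q) ≡ ind (does (v ≟ y)) + indeg y ((shortcut , β) ∷ P ++ Q)
      indeg-routed false P Q y
        rewrite sumBy-shift (λ o → ind (does (head o ≟ y))) (e1 , f1) (e2 , f2) P Q
              | sumBy-shift' (λ o → ind (does (head o ≟ y))) (shortcut , false) P Q
              = regroup₂ (ind (does (v ≟ y))) (ind (does (w ≟ y))) (indeg y P) (indeg y Q)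
      indeg-routed true P Q y
        rewrite sumBy-shift (λ o → ind (does (head o ≟ y))) (e1 , not f1) (e2 , not f2) P Q
              | sumBy-shift' (λ o → ind (does (head o ≟ y))) (shortcut , true) P Q
              | hd-not e1 f1 | hd-not e2 f2 | sym joint = regroup₁ (ind (does (u ≟ y))) (ind (does (v ≟ y))) (indeg y P) (indeg y Q)

      splice : ∀ pre post → Orientation (shortcut ∷ pre ++ post) → Orientation (e1 ∷ pre ++ e2 ∷ post)
      splice pre post ((c , β) ∷ OL , edgeOf-eq , bal) with map-++-inv edgeOf OL pre post (LP.∷-injectiveʳ edgeOf-eq)
      ... | OLp , OLq , refl , edgeOf-p , edgeOf-q = routed β OLp OLq , edgeOf-routed , bal-routed
        where
        edgeOf-routed : map edgeOf (routed β OLp OLq) ≡ e1 ∷ pre ++ e2 ∷ post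
        edgeOf-routed = cong (e1 ∷_) (trans (LP.map-++ edgeOf OLp ((e2 , flipIf β f2) ∷ OLq))
                                           (cong₂ (λ P Q → P ++ e2 ∷ Q) edgeOf-p edgeOf-q))

        bal-shortcut : Balanced ((shortcut , β) ∷ OLp ++ OLq)
        bal-shortcut = subst (λ c → Balanced ((c , β) ∷ OLp ++ OLq)) (LP.∷-injectiveˡ edgeOf-eq) bal

        bal-routed : Balanced (routed β OLp OLq)
        bal-routed y = balanced-+ (ind (does (v ≟ y))) (outdeg-routed β OLp OLq y) (indeg-routed β OLp OLq y) (bal-shortcut y)

    isolated-edge : ∀ e rest → ¬ Any (Shares e) rest → Orientation rest → Orientation (e ∷ rest)
    isolated-edge e rest unshared (OL , edgeOf-eq , bal) = (e , false) ∷ OL , cong (e ∷_) edgeOf-eq , bal-e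
      where
      untouched : ∀ y f → hd e f ≡ y → All (λ o → tail o ≢ y × head o ≢ y) OL
      untouched y f hy = All.tabulate λ {o} o∈OL →
        let unshared-o : ¬ Shares e (edgeOf o)
            unshared-o s = unshared (Any.map (λ { refl → s }) (subst (edgeOf o ∈_) edgeOf-eq (∈-map⁺ edgeOf o∈OL)))
        in (λ t → unshared-o (f , proj₂ o , trans hy (sym t))) ,
           (λ t → unshared-o (f , not (proj₂ o) , trans hy (sym (trans (tl-not (edgeOf o) (proj₂ o)) t))))

      counts-0 : ∀ y f → hd e f ≡ y → outdeg y OL ≡ 0 × indeg y OL ≡ 0
      counts-0 y f hy = sumBy-0All (All.map (λ { (p , _) → cong ind (does-no _≟_ p) }) (untouched y f hy)) ,
                        sumBy-0All (All.map (λ { (_ , q) → cong ind (does-no _≟_ q) }) (untouched y f hy))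

      ≤1-balanced : ∀ a b → a ≤ 1 → b ≤ 1 → a + 0 ≤ suc (b + 0) × b + 0 ≤ suc (a + 0)
      ≤1-balanced a b p q = ≤-trans (≤-reflexive (+-identityʳ a)) (≤-trans p (s≤s z≤n)) ,
                            ≤-trans (≤-reflexive (+-identityʳ b)) (≤-trans q (s≤s z≤n))

      bal-e : Balanced ((e , false) ∷ OL)
      bal-e y with proj₁ e ≟ y | proj₂ e ≟ y
      ... | yes p | _ rewrite proj₁ (counts-0 y true p) | proj₂ (counts-0 y true p) = ≤1-balanced _ _ (ind≤1 _) (ind≤1 _)
      ... | no _ | yes q rewrite proj₁ (counts-0 y false q) | proj₂ (counts-0 y false q) = ≤1-balanced _ _ (ind≤1 _) (ind≤1 _)
      ... | no _ | no _ = bal y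

    balanced-orientation-by-length : ∀ k (E : List (V × V)) → length E ≡ k → Orientation E
    balanced-orientation-by-length k [] _ = [] , refl , (λ y → z≤n , z≤n)
    balanced-orientation-by-length (suc k) (e1 ∷ rest) len with any? (shares? e1) rest
    ... | no unshared = isolated-edge e1 rest unshared (balanced-orientation-by-length k rest (suc-injective len))
    ... | yes shared with splitAny shared
    ...   | pre , post , e2 , refl , f1 , f2 , joint =
      splice pre post (balanced-orientation-by-length k (shortcut ∷ pre ++ post) len')
      where
      open Splice e1 e2 f1 f2 joint
      len' : length (shortcut ∷ pre ++ post) ≡ k
      len' = suc-injective (begin
        suc (suc (length (pre ++ post)))     ≡⟨ cong (suc ∘ suc) (LP.length-++ pre) ⟩
        suc (suc (length pre + length post)) ≡⟨ cong suc (+-suc (length pre) (length post)) ⟨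
        suc (length pre + length (e2 ∷ post)) ≡⟨ cong suc (LP.length-++ pre) ⟨
        length (e1 ∷ pre ++ e2 ∷ post)       ≡⟨ len ⟩
        suc k                                ∎)
        where open ≡-Reasoning

    balanced-orientation : ∀ (E : List (V × V)) → Orientation E
    balanced-orientation E = balanced-orientation-by-length (length E) E refl

module SplitColouring where

  open Sums
  open Blocks
  open BipartiteEdgeColouring
  open BalancedOrientation
  open import Data.Nat using (ℕ; zero; suc; _+_; _*_; _≤_; _<_; z≤n; _<?_; _/_)
  open import Data.Nat.DivMod using (m<n*o⇒m/o<n)
  import Data.Nat as ℕ
  open import Data.Nat.Properties
  open import Data.Fin using (zero; suc)
  open import Data.Bool using (Bool; true; false; _∧_; if_then_else_)
  import Data.Bool as Bool
  open import Data.Bool.Properties using (∨-identityʳ; ∧-identityʳ; ∧-commutativeMonoid)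
  open import Algebra.Bundles using (CommutativeMonoid)
  open import Algebra.Properties.CommutativeSemigroup (CommutativeMonoid.commutativeSemigroup ∧-commutativeMonoid) using (xy∙z≈xz∙y)
  open import Data.List using (List; []; _∷_; map; allFin; length)
  import Data.List.Properties as LP
  open import Data.List.Relation.Unary.All using (All; []; _∷_)
  import Data.List.Relation.Unary.All as All
  open import Data.List.Relation.Unary.Any using (here; there)
  open import Data.List.Membership.Propositional using (_∈_)
  open import Data.List.Membership.Propositional.Properties using (∈-allFin; ∈-map⁺)
  open import Data.List.Relation.Unary.Unique.Propositional using (Unique)
  import Data.List.Relation.Unary.Unique.Propositional.Properties as UP
  open import Data.List.Relation.Unary.AllPairs using ([]; _∷_)
  open import Data.Product using (Σ; _×_; _,_; proj₁; proj₂)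
  open import Data.Product.Properties using (≡-dec)
  open import Data.Empty using (⊥-elim)
  open import Relation.Nullary using (yes; no; does)
  open import Relation.Nullary.Decidable using (dec-true; map′; _×-dec_)
  open import Relation.Binary.PropositionalEquality
  open import Relation.Binary.Definitions using (DecidableEquality)

  lookupBy : ∀ {A K C : Set} (key : A → K) (_≟K_ : DecidableEquality K) (col : A → C) (d : C) → List A → K → C
  lookupBy key _≟K_ col d [] k = d
  lookupBy key _≟K_ col d (e ∷ es) k = if does (key e ≟K k) then col e else lookupBy key _≟K_ col d es k

  lookupBy-∈ : ∀ {A K C : Set} (key : A → K) (_≟K_ : DecidableEquality K) (col : A → C) (d : C) (es : List A) →
             Unique (map key es) → ∀ {e} → e ∈ es → lookupBy key _≟K_ col d es (key e) ≡ col e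
  lookupBy-∈ key _≟K_ col d (e ∷ es) u (here refl) rewrite does-refl _≟K_ (key e) = refl
  lookupBy-∈ key _≟K_ col d (e' ∷ es) (h ∷ u) {e} (there m) rewrite does-no _≟K_ (All.lookup h (∈-map⁺ key m)) = lookupBy-∈ key _≟K_ col d es u m

  balanced-bounds : ∀ {o i P Q} → o ≤ suc i → i ≤ suc o → P + P ≤ o + i → o + i ≤ Q + Q → P ≤ o × o ≤ Q
  balanced-bounds {o} {i} {P} {Q} o≤1+i i≤1+o 2P≤o+i o+i≤2Q = P≤o , o≤Q
    where
    P≤o : P ≤ o
    P≤o with P ≤? o
    ... | yes P≤o = P≤o
    ... | no P≰o = ⊥-elim (<⇒≱ (+-mono-<-≤ (≰⇒> P≰o) (≤-trans i≤1+o (≰⇒> P≰o))) 2P≤o+i)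
    o≤Q : o ≤ Q
    o≤Q with o ≤? Q
    ... | yes o≤Q = o≤Q
    ... | no o≰Q = ⊥-elim (<⇒≱ (+-mono-<-≤ (≰⇒> o≰Q) (≤-pred (≤-trans (≰⇒> o≰Q) o≤1+i))) o+i≤2Q)

  module Split {W : Set} (_≟W_ : DecidableEquality W) (x' : ℕ) where
    open OrientedEdges _≟W_
    open BlockCount x'

    -- The split graph: (false , y , m) is the m-th block of x arcs leaving y, (true , y , m)
    -- the m-th block of x arcs entering y, where an arc's position at y is the number of arcs
    -- after it in the list sharing that end. An arc joins the out-block of its tail to the
    -- in-block of its head, so the split graph is bipartite with maximum degree x.
    BlockVertex : Set
    BlockVertex = Bool × W × ℕ

    -- Not ≡-dec: this way does (u ≟B v) reduces to the conjunction of the componentwise tests.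
    _≟B_ : DecidableEquality BlockVertex
    d ≟B d' = map′ (λ { (p , q , r) → cong₂ _,_ p (cong₂ _,_ q r) })
                   (λ e → cong proj₁ e , cong (λ z → proj₁ (proj₂ z)) e , cong (λ z → proj₂ (proj₂ z)) e)
                   (proj₁ d Bool.≟ proj₁ d' ×-dec (proj₁ (proj₂ d) ≟W proj₁ (proj₂ d') ×-dec proj₂ (proj₂ d) ℕ.≟ proj₂ (proj₂ d')))

    _≟WW_ : DecidableEquality (W × W)
    _≟WW_ = ≡-dec _≟W_ _≟W_

    _≟A_ : DecidableEquality Arc
    _≟A_ = ≡-dec _≟WW_ Bool._≟_

    BlockEdge : Set
    BlockEdge = Arc × BlockVertex × BlockVertex

    _≟E_ : DecidableEquality BlockEdge
    _≟E_ = ≡-dec _≟A_ (≡-dec _≟B_ _≟B_)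

    open EdgeColouring _≟B_ _≟E_ (λ e → proj₁ (proj₂ e)) (λ e → proj₂ (proj₂ e)) proj₁ x' public

    blockEdge : Arc → List Arc → BlockEdge
    blockEdge o os = o , (false , tail o , outdeg (tail o) os / x) , (true , head o , indeg (head o) os / x)

    blockEdges : List Arc → List BlockEdge
    blockEdges [] = []
    blockEdges (o ∷ os) = blockEdge o os ∷ blockEdges os

    end : Bool → Arc → W
    end false = tail
    end true = head

    arcCount : Bool → W → List Arc → ℕ
    arcCount false = outdeg
    arcCount true = indeg

    blockIndex : Bool → BlockEdge → ℕ
    blockIndex false e = proj₂ (proj₂ (proj₁ (proj₂ e)))
    blockIndex true e = proj₂ (proj₂ (proj₂ (proj₂ e)))

    blockIndex-blockEdge : ∀ b o os → blockIndex b (blockEdge o os) ≡ arcCount b (end b o) os / x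
    blockIndex-blockEdge false o os = refl
    blockIndex-blockEdge true o os = refl

    incident-blockEdge : ∀ b y m o os → incident (b , y , m) (blockEdge o os) ≡ does (end b o ≟W y) ∧ does (arcCount b (end b o) os / x ℕ.≟ m)
    incident-blockEdge false y m o os = ∨-identityʳ _
    incident-blockEdge true y m o os = refl

    arcCount-∷ : ∀ b y o os → arcCount b y (o ∷ os) ≡ ind (does (end b o ≟W y)) + arcCount b y os
    arcCount-∷ false y o os = refl
    arcCount-∷ true y o os = refl

    arcCount-[] : ∀ b y → arcCount b y [] ≡ 0
    arcCount-[] false y = refl
    arcCount-[] true y = refl

    deg-blockEdges : ∀ b y m os → deg (b , y , m) (blockEdges os) ≡ blockCount m (arcCount b y os)
    deg-blockEdges b y m [] rewrite arcCount-[] b y = refl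
    deg-blockEdges b y m (o ∷ os) rewrite incident-blockEdge b y m o os | arcCount-∷ b y o os | deg-blockEdges b y m os with end b o ≟W y
    ... | yes refl = refl
    ... | no _ = refl

    deg-blockEdges≤ : ∀ os z → deg z (blockEdges os) ≤ suc x'
    deg-blockEdges≤ os (b , y , m) rewrite deg-blockEdges b y m os = blockCount≤ m (arcCount b y os)

    blockEdges-LeftToRight : ∀ os → All LeftToRight (blockEdges os)
    blockEdges-LeftToRight [] = []
    blockEdges-LeftToRight (o ∷ os) = (refl , refl) ∷ blockEdges-LeftToRight os

    map-arc-blockEdges : ∀ os → map proj₁ (blockEdges os) ≡ os
    map-arc-blockEdges [] = refl
    map-arc-blockEdges (o ∷ os) = cong (o ∷_) (map-arc-blockEdges os)

    blockEdges-unique : ∀ os → Unique (map edgeOf os) → Unique (blockEdges os)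
    blockEdges-unique os u = UP.map⁻ (subst Unique (sym (map-arc-blockEdges os)) (UP.map⁻ u))

    sumBy-blockEdges : ∀ (h : Arc → ℕ) os → sumBy (λ e → h (proj₁ e)) (blockEdges os) ≡ sumBy h os
    sumBy-blockEdges h [] = refl
    sumBy-blockEdges h (o ∷ os) = cong (h o +_) (sumBy-blockEdges h os)

    module ArcColours (col : BlockEdge → C) where
      atEndWithColour : Bool → C → W → BlockEdge → Bool
      atEndWithColour b k y e = does (end b (proj₁ e) ≟W y) ∧ (col e == k)

      arcColourCount : Bool → C → W → List Arc → ℕ
      arcColourCount b k y os = sumBy (λ e → ind (atEndWithColour b k y e)) (blockEdges os)

      inBlock : Bool → C → W → ℕ → List Arc → ℕ
      inBlock b k y m os = sumBy (λ e → ind (atEndWithColour b k y e ∧ does (blockIndex b e ℕ.≟ m))) (blockEdges os)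

      inBlocksBelow : Bool → C → W → ℕ → List Arc → ℕ
      inBlocksBelow b k y M os = sumBy (λ e → ind (atEndWithColour b k y e ∧ does (blockIndex b e <? M))) (blockEdges os)

      inBlocksBelow≡sumBelow : ∀ b k y M os → inBlocksBelow b k y M os ≡ sumBelow M (λ m → inBlock b k y m os)
      inBlocksBelow≡sumBelow b k y M os = sum-below-by-blocks (atEndWithColour b k y) (blockIndex b) M (blockEdges os)

      colourDeg-blockEdges : ∀ b y m k os → colourDeg col (b , y , m) k (blockEdges os) ≡ inBlock b k y m os
      colourDeg-blockEdges b y m k [] = refl
      colourDeg-blockEdges b y m k (o ∷ os) rewrite incident-blockEdge b y m o os | blockIndex-blockEdge b o os =
        cong₂ _+_ (cong ind (xy∙z≈xz∙y (does (end b o ≟W y)) _ _)) (colourDeg-blockEdges b y m k os)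

      inBlocksBelow≡arcColourCount : ∀ b y k M os → arcCount b y os ≤ M * x → inBlocksBelow b k y M os ≡ arcColourCount b k y os
      inBlocksBelow≡arcColourCount b y k M [] le = refl
      inBlocksBelow≡arcColourCount b y k M (o ∷ os) le =
        cong₂ _+_ first (inBlocksBelow≡arcColourCount b y k M os (≤-trans (m≤n+m _ _) (≤-trans (≤-reflexive (sym (arcCount-∷ b y o os))) le)))
        where
        index<M : end b o ≡ y → arcCount b y os / x < M
        index<M refl = m<n*o⇒m/o<n (begin-strict
          arcCount b y os                         <⟨ n<1+n _ ⟩
          1 + arcCount b y os                     ≡⟨ cong (λ c → ind c + arcCount b y os) (does-refl _≟W_ y) ⟨
          ind (does (y ≟W y)) + arcCount b y os   ≡⟨ arcCount-∷ b y o os ⟨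
          arcCount b y (o ∷ os)                   ≤⟨ le ⟩
          M * x                                   ∎)
          where open ≤-Reasoning

        first : ind (atEndWithColour b k y (blockEdge o os) ∧ does (blockIndex b (blockEdge o os) <? M)) ≡ ind (atEndWithColour b k y (blockEdge o os))
        first with end b o ≟W y
        ... | no _ = refl
        ... | yes refl rewrite blockIndex-blockEdge b o os | dec-true (arcCount b (end b o) os / x <? M) (index<M refl) =
          cong ind (∧-identityʳ _)

      -- The arcs at y fill at most q blocks and each block meets colour k at most once.
      arcColourCount≤ : ∀ b y k q os → Proper col (blockEdges os) → arcCount b y os ≤ q * x → arcColourCount b k y os ≤ q
      arcColourCount≤ b y k q os proper le = begin
        arcColourCount b k y os             ≡⟨ inBlocksBelow≡arcColourCount b y k q os le ⟨
        inBlocksBelow b k y q os            ≡⟨ inBlocksBelow≡sumBelow b k y q os ⟩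
        sumBelow q (λ m → inBlock b k y m os) ≤⟨ sumBelow-mono q _ _ (λ m _ → subst (_≤ 1) (colourDeg-blockEdges b y m k os) (proper (b , y , m) k)) ⟩
        sumBelow q (λ _ → 1)                ≡⟨ sumBelow-ones q ⟩
        q                                   ∎
        where open ≤-Reasoning

      full-vertex-sees-every-colour : ∀ z es → Proper col es → deg z es ≡ suc x' → ∀ k → 1 ≤ colourDeg col z k es
      full-vertex-sees-every-colour z es proper dg k with colourDeg col z k es ℕ.≟ 0
      ... | no ne = n≢0⇒n>0 ne
      ... | yes e0 = ⊥-elim (<-irrefl refl (begin-strict
            suc x'                                               ≡⟨ dg ⟨
            deg z es                                             ≡⟨ colour-counts-sum col z es ⟨
            sumBy (λ k → colourDeg col z k es) (allFin (suc x')) <⟨ sumBy-len< (allFin (suc x')) (λ k' → proper z k') (∈-allFin k) e0 ⟩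
            length (allFin (suc x'))                             ≡⟨ length-allFin (suc x') ⟩
            suc x'                                               ∎))
        where open ≤-Reasoning

      -- The first p blocks at y are full, i.e. vertices of degree x, and so meet every colour.
      arcColourCount≥ : ∀ b y k p os → Proper col (blockEdges os) → p * x ≤ arcCount b y os → p ≤ arcColourCount b k y os
      arcColourCount≥ b y k p os proper le = begin
        p                                   ≡⟨ sumBelow-ones p ⟨
        sumBelow p (λ _ → 1)                ≤⟨ sumBelow-mono p _ _ block-sees-k ⟩
        sumBelow p (λ m → inBlock b k y m os) ≡⟨ inBlocksBelow≡sumBelow b k y p os ⟨
        inBlocksBelow b k y p os            ≤⟨ sumBy-mono (blockEdges os) (λ e → ind-∧ (atEndWithColour b k y e) _) ⟩
        arcColourCount b k y os             ∎
        where
        open ≤-Reasoning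
        block-sees-k : ∀ m → m < p → 1 ≤ inBlock b k y m os
        block-sees-k m m<p = subst (1 ≤_) (colourDeg-blockEdges b y m k os)
          (full-vertex-sees-every-colour (b , y , m) (blockEdges os) proper
            (trans (deg-blockEdges b y m os) (blockCount-full m (arcCount b y os) (≤-trans (*-monoˡ-≤ x m<p) le))) k)
        ind-∧ : ∀ a c → ind (a ∧ c) ≤ ind a
        ind-∧ true true = ≤-refl
        ind-∧ true false = z≤n
        ind-∧ false c = z≤n

    edgeDeg : W → List (W × W) → ℕ
    edgeDeg y = sumBy (λ e → ind (does (proj₁ e ≟W y)) + ind (does (proj₂ e ≟W y)))

    edgeColourDeg : (W × W → C) → C → W → List (W × W) → ℕ
    edgeColourDeg edgeColour k y = sumBy (λ e → ind (does (proj₁ e ≟W y) ∧ (edgeColour e == k)) + ind (does (proj₂ e ≟W y) ∧ (edgeColour e == k)))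

    module _ {E : List (W × W)} {OL : List Arc} (edgeOf-OL : map edgeOf OL ≡ E) where
      outdeg+indeg≡edgeDeg : ∀ y → outdeg y OL + indeg y OL ≡ edgeDeg y E
      outdeg+indeg≡edgeDeg y = begin
        outdeg y OL + indeg y OL                                                   ≡⟨ sumBy-+ _ _ OL ⟨
        sumBy (λ o → ind (does (tail o ≟W y)) + ind (does (head o ≟W y))) OL    ≡⟨ sumBy-cong OL ends-unordered ⟩
        sumBy (λ o → ind (does (proj₁ (edgeOf o) ≟W y)) + ind (does (proj₂ (edgeOf o) ≟W y))) OL ≡⟨ sumBy-map _ edgeOf OL ⟨
        edgeDeg y (map edgeOf OL)                                                  ≡⟨ cong (edgeDeg y) edgeOf-OL ⟩
        edgeDeg y E                                                               ∎
        where
        open ≡-Reasoning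
        ends-unordered : ∀ o → ind (does (tail o ≟W y)) + ind (does (head o ≟W y))
                             ≡ ind (does (proj₁ (edgeOf o) ≟W y)) + ind (does (proj₂ (edgeOf o) ≟W y))
        ends-unordered ((a , b) , false) = refl
        ends-unordered ((a , b) , true) = +-comm (ind (does (b ≟W y))) _

      module _ (col : BlockEdge → C) (edgeColour : W × W → C)
               (edgeColour-blockEdges : All (λ e → edgeColour (edgeOf (proj₁ e)) ≡ col e) (blockEdges OL)) where
        open ArcColours col

        edgeColourDeg≡arcColourCounts : ∀ y k → edgeColourDeg edgeColour k y E ≡ arcColourCount false k y OL + arcColourCount true k y OL
        edgeColourDeg≡arcColourCounts y k = begin
          edgeColourDeg edgeColour k y E                                  ≡⟨ cong (sumBy g) edgeOf-OL ⟨
          sumBy g (map edgeOf OL)                         ≡⟨ sumBy-map g edgeOf OL ⟩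
          sumBy (λ o → g (edgeOf o)) OL                   ≡⟨ sumBy-blockEdges (λ o → g (edgeOf o)) OL ⟨
          sumBy (λ e → g (edgeOf (proj₁ e))) (blockEdges OL)     ≡⟨ sumBy-congAll (All.map (λ {e} eq → pw e eq) edgeColour-blockEdges) ⟩
          sumBy (λ e → ind (atEndWithColour false k y e) + ind (atEndWithColour true k y e)) (blockEdges OL) ≡⟨ sumBy-+ _ _ (blockEdges OL) ⟩
          arcColourCount false k y OL + arcColourCount true k y OL               ∎
          where
          open ≡-Reasoning
          g : W × W → ℕ
          g e = ind (does (proj₁ e ≟W y) ∧ (edgeColour e == k)) + ind (does (proj₂ e ≟W y) ∧ (edgeColour e == k))
          ends-unordered : ∀ (o : Arc) (c : C) →
            ind (does (proj₁ (edgeOf o) ≟W y) ∧ (c == k)) + ind (does (proj₂ (edgeOf o) ≟W y) ∧ (c == k)) ≡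
            ind (does (tail o ≟W y) ∧ (c == k)) + ind (does (head o ≟W y) ∧ (c == k))
          ends-unordered ((a , b) , false) c = refl
          ends-unordered ((a , b) , true) c = +-comm (ind (does (a ≟W y) ∧ (c == k))) _
          pw : ∀ e → edgeColour (edgeOf (proj₁ e)) ≡ col e → g (edgeOf (proj₁ e)) ≡ ind (atEndWithColour false k y e) + ind (atEndWithColour true k y e)
          pw e eq rewrite eq = ends-unordered (proj₁ e) (col e)

    equitable-colouring : ∀ p q (E : List (W × W)) → Unique E →
      (∀ y → (p + p) * x ≤ edgeDeg y E × edgeDeg y E ≤ (q + q) * x) →
      Σ (W × W → C) λ edgeColour → ∀ y k → p + p ≤ edgeColourDeg edgeColour k y E × edgeColourDeg edgeColour k y E ≤ q + q
    equitable-colouring p q E unique-E deg-E with balanced-orientation E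
    ... | OL , edgeOf-OL , bal = edgeColour , bounds
      where
      unique-OL : Unique (map edgeOf OL)
      unique-OL = subst Unique (sym edgeOf-OL) unique-E

      coloured : Σ (BlockEdge → C) (λ col → Proper col (blockEdges OL))
      coloured = konig (blockEdges OL) (blockEdges-LeftToRight OL) (blockEdges-unique OL unique-OL) (deg-blockEdges≤ OL)
      col : BlockEdge → C
      col = proj₁ coloured
      proper : Proper col (blockEdges OL)
      proper = proj₂ coloured
      open ArcColours col

      arcOf : BlockEdge → W × W
      arcOf e = edgeOf (proj₁ e)

      edgeColour : W × W → C
      edgeColour = lookupBy arcOf _≟WW_ col zero (blockEdges OL)

      edgeColour-blockEdges : All (λ e → edgeColour (arcOf e) ≡ col e) (blockEdges OL)
      edgeColour-blockEdges = All.tabulate (lookupBy-∈ arcOf _≟WW_ col zero (blockEdges OL) unique-arcs)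
        where
        unique-arcs : Unique (map arcOf (blockEdges OL))
        unique-arcs = subst Unique (sym (trans (LP.map-∘ (blockEdges OL)) (cong (map edgeOf) (map-arc-blockEdges OL)))) unique-OL

      half-bounds : ∀ y {o i} → o ≤ suc i → i ≤ suc o → o + i ≡ edgeDeg y E → p * x ≤ o × o ≤ q * x
      half-bounds y o≤ i≤ o+i≡ = balanced-bounds o≤ i≤
        (subst₂ _≤_ (*-distribʳ-+ x p p) (sym o+i≡) (proj₁ (deg-E y)))
        (subst₂ _≤_ (sym o+i≡) (*-distribʳ-+ x q q) (proj₂ (deg-E y)))

      arc-bounds : ∀ b y → p * x ≤ arcCount b y OL × arcCount b y OL ≤ q * x
      arc-bounds false y = half-bounds y (proj₁ (bal y)) (proj₂ (bal y)) (outdeg+indeg≡edgeDeg edgeOf-OL y)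
      arc-bounds true y = half-bounds y (proj₂ (bal y)) (proj₁ (bal y)) (trans (+-comm (indeg y OL) _) (outdeg+indeg≡edgeDeg edgeOf-OL y))

      bounds : ∀ y k → p + p ≤ edgeColourDeg edgeColour k y E × edgeColourDeg edgeColour k y E ≤ q + q
      bounds y k rewrite edgeColourDeg≡arcColourCounts edgeOf-OL col edgeColour edgeColour-blockEdges y k =
        +-mono-≤ (arcColourCount≥ false y k p OL proper (proj₁ (arc-bounds false y)))
                 (arcColourCount≥ true y k p OL proper (proj₁ (arc-bounds true y))) ,
        +-mono-≤ (arcColourCount≤ false y k q OL proper (proj₂ (arc-bounds false y)))
                 (arcColourCount≤ true y k q OL proper (proj₂ (arc-bounds true y)))

module EdgeList where

  open import Defs using (Graph; adj; irrefl)
  import Defs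
  open Sums
  open import Data.Nat using (ℕ; _+_)
  open import Data.Nat.Properties using (+-identityʳ)
  open import Data.Fin using (Fin; _<?_; _≟_)
  import Data.Fin.Properties as FP
  open import Data.Bool using (Bool; true; false; _∧_; if_then_else_)
  open import Data.List using (List; allFin; cartesianProduct; filterᵇ)
  open import Data.List.Relation.Unary.Unique.Propositional using (Unique)
  import Data.List.Relation.Unary.Unique.Propositional.Properties as UP
  open import Data.Product using (_×_; _,_; proj₁; proj₂)
  open import Relation.Nullary using (does)
  open import Relation.Nullary.Decidable using (T?; dec-true; dec-false)
  open import Relation.Binary.PropositionalEquality
  open import Function using (_∘_)
  open import Relation.Binary.Definitions using (tri<; tri≈; tri>)

  module Edges {n : ℕ} (G : Graph n) where
    W : Set
    W = Fin n

    isEdge : W × W → Bool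
    isEdge e = does (proj₁ e <? proj₂ e) ∧ adj G (proj₁ e) (proj₂ e)

    edges : List (W × W)
    edges = filterᵇ isEdge (cartesianProduct (allFin n) (allFin n))

    unique-edges : Unique edges
    unique-edges = UP.filter⁺ (λ e → T? (isEdge e)) (UP.cartesianProduct⁺ (UP.allFin⁺ n) (UP.allFin⁺ n))

    restrict : (W × W → ℕ) → W × W → ℕ
    restrict w e = if isEdge e then w e else 0

    ΣΣ : (W × W → ℕ) → ℕ
    ΣΣ w = sumBy (λ i → sumBy (λ j → w (i , j)) (allFin n)) (allFin n)

    sumBy-edges : ∀ w → sumBy w edges ≡ ΣΣ (restrict w)
    sumBy-edges w = trans (sumBy-filter w isEdge (cartesianProduct (allFin n) (allFin n))) (sumBy-cartesianProduct (restrict w) (allFin n) (allFin n))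

    ΣΣ-restrict-+ : ∀ w v → ΣΣ (restrict (λ e → w e + v e)) ≡ ΣΣ (restrict w) + ΣΣ (restrict v)
    ΣΣ-restrict-+ w v = trans (sumBy-cong (allFin n) λ i → trans (sumBy-cong (allFin n) λ j → restrict-+ (i , j)) (sumBy-+ _ _ (allFin n)))
                              (sumBy-+ _ _ (allFin n))
      where
      restrict-+ : ∀ e → restrict (λ e → w e + v e) e ≡ restrict w e + restrict v e
      restrict-+ e with isEdge e
      ... | true = refl
      ... | false = refl

    restrict-0 : ∀ {w} e → w e ≡ 0 → restrict w e ≡ 0
    restrict-0 e w≡0 with isEdge e
    ... | true = w≡0
    ... | false = refl

    module _ (y : W) (Q : W × W → Bool) where
      fromY toY : W × W → ℕ
      fromY e = ind (does (proj₁ e ≟ y) ∧ Q e)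
      toY e = ind (does (proj₂ e ≟ y) ∧ Q e)

      incidenceSum : ℕ
      incidenceSum = sumBy (λ e → fromY e + toY e) edges

      Q-at : W → Bool
      Q-at j = if does (y <? j) then Q (y , j) else Q (j , y)

      ΣΣ-fromY : ΣΣ (restrict fromY) ≡ sumBy (λ j → restrict (ind ∘ Q) (y , j)) (allFin n)
      ΣΣ-fromY = trans (sumBy-allFin-single y _ λ i i≢y → sumBy-0 (allFin n) λ j →
                          restrict-0 {fromY} (i , j) (cong (λ b → ind (b ∧ Q (i , j))) (does-no _≟_ i≢y)))
                       (sumBy-cong (allFin n) λ j → cong (λ b → restrict (λ e → ind (b ∧ Q e)) (y , j)) (does-refl _≟_ y))

      ΣΣ-toY : ΣΣ (restrict toY) ≡ sumBy (λ i → restrict (ind ∘ Q) (i , y)) (allFin n)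
      ΣΣ-toY = sumBy-cong (allFin n) λ i →
        trans (sumBy-allFin-single y _ (λ j j≢y → restrict-0 {toY} (i , j) (cong (λ b → ind (b ∧ Q (i , j))) (does-no _≟_ j≢y))))
              (cong (λ b → restrict (λ e → ind (b ∧ Q e)) (i , y)) (does-refl _≟_ y))

      -- Since i < j on edges, the pairs (y , j) and (j , y) cover each neighbour j of y once.
      both-orders : ∀ j → restrict (ind ∘ Q) (y , j) + restrict (ind ∘ Q) (j , y) ≡ ind (adj G y j ∧ Q-at j)
      both-orders j with FP.<-cmp y j
      ... | tri< l _ g rewrite dec-true (y <? j) l | dec-false (j <? y) g with adj G y j
      ...   | true = +-identityʳ _
      ...   | false = refl
      both-orders j | tri> l _ g rewrite dec-false (y <? j) l | dec-true (j <? y) g | sym (Defs.Graph.sym G y j) with adj G y j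
      ...   | true = refl
      ...   | false = refl
      both-orders j | tri≈ l refl g rewrite dec-false (y <? y) l | irrefl G y = refl

      incidenceSum-by-neighbours : incidenceSum ≡ sumBy (λ j → ind (adj G y j ∧ Q-at j)) (allFin n)
      incidenceSum-by-neighbours = begin
        incidenceSum                                        ≡⟨ sumBy-edges _ ⟩
        ΣΣ (restrict (λ e → fromY e + toY e))               ≡⟨ ΣΣ-restrict-+ fromY toY ⟩
        ΣΣ (restrict fromY) + ΣΣ (restrict toY)             ≡⟨ cong₂ _+_ ΣΣ-fromY ΣΣ-toY ⟩
        sumBy (λ j → restrict (ind ∘ Q) (y , j)) (allFin n) + sumBy (λ j → restrict (ind ∘ Q) (j , y)) (allFin n)
                                                            ≡⟨ sumBy-+ _ _ (allFin n) ⟨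
        sumBy (λ j → restrict (ind ∘ Q) (y , j) + restrict (ind ∘ Q) (j , y)) (allFin n)
                                                            ≡⟨ sumBy-cong (allFin n) both-orders ⟩
        sumBy (λ j → ind (adj G y j ∧ Q-at j)) (allFin n)   ∎
        where open ≡-Reasoning

module EvenFactorization where

  open import Defs using (Graph; adj; irrefl; countB; degree; degreeIn; HasFactorization)
  open Sums
  open EdgeList
  open SplitColouring
  open import Data.Nat using (ℕ; suc; _+_; _*_; _≤_; s≤s; z≤n)
  open import Data.Nat.Divisibility using (_∣_; divides)
  open import Data.Nat.Tactic.RingSolver using (solve-∀)
  open import Data.Fin using (Fin; _<?_; _≟_)
  import Data.Fin.Properties as FP
  open import Data.Bool using (Bool; true; false; _∧_; if_then_else_)
  open import Data.Bool.Properties using (∧-identityʳ)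
  open import Data.List using (allFin)
  open import Data.Product using (Σ; _×_; _,_; proj₁; proj₂)
  open import Relation.Nullary using (does)
  open import Relation.Nullary.Decidable using (dec-true; dec-false)
  open import Relation.Binary.PropositionalEquality
  open import Relation.Binary.Definitions using (tri<; tri≈; tri>)

  countB≡sumBy : ∀ {n} (p : Fin n → Bool) → countB p ≡ sumBy (λ j → ind (p j)) (allFin n)
  countB≡sumBy {n} p = trans (sum-map≡sumBy _ (allFin n)) (sumBy-cong (allFin n) if≡ind)
    where
    if≡ind : ∀ j → (if p j then 1 else 0) ≡ ind (p j)
    if≡ind j with p j
    ... | true = refl
    ... | false = refl

  module _ {n} (G : Graph n) where
    open Edges G

    symmetrize : ∀ {C : Set} → (Fin n × Fin n → C) → Fin n → Fin n → C
    symmetrize col i j = if does (i <? j) then col (i , j) else col (j , i)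

    symmetrize-sym : ∀ {C : Set} (col : Fin n × Fin n → C) i j → adj G i j ≡ true →
                     symmetrize col i j ≡ symmetrize col j i
    symmetrize-sym col i j e with FP.<-cmp i j
    ... | tri< l _ g rewrite dec-true (i <? j) l | dec-false (j <? i) g = refl
    ... | tri> l _ g rewrite dec-false (i <? j) l | dec-true (j <? i) g = refl
    ... | tri≈ _ refl _ rewrite irrefl G i with e
    ...   | ()

    module _ (x' : ℕ) where
      open Split {Fin n} _≟_ x'

      edgeDeg≡degree : ∀ y → edgeDeg y edges ≡ degree G y
      edgeDeg≡degree y = begin
        edgeDeg y edges                                                  ≡⟨ sumBy-cong edges ∧-true ⟨
        incidenceSum y (λ _ → true)                                      ≡⟨ incidenceSum-by-neighbours y (λ _ → true) ⟩
        sumBy (λ j → ind (adj G y j ∧ Q-at y (λ _ → true) j)) (allFin n) ≡⟨ sumBy-cong (allFin n) (λ j → cong ind (∧-Q-at j)) ⟩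
        sumBy (λ j → ind (adj G y j)) (allFin n)                         ≡⟨ countB≡sumBy (adj G y) ⟨
        degree G y                                                       ∎
        where
        open ≡-Reasoning
        ∧-true : ∀ e → ind (does (proj₁ e ≟ y) ∧ true) + ind (does (proj₂ e ≟ y) ∧ true)
                     ≡ ind (does (proj₁ e ≟ y)) + ind (does (proj₂ e ≟ y))
        ∧-true e = cong₂ _+_ (cong ind (∧-identityʳ (does (proj₁ e ≟ y)))) (cong ind (∧-identityʳ (does (proj₂ e ≟ y))))
        ∧-Q-at : ∀ j → adj G y j ∧ Q-at y (λ _ → true) j ≡ adj G y j
        ∧-Q-at j with does (y <? j)
        ... | true = ∧-identityʳ _
        ... | false = ∧-identityʳ _

      degreeIn≡edgeColourDeg : ∀ edgeColour k v → degreeIn G (symmetrize edgeColour) k v ≡ edgeColourDeg edgeColour k v edges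
      degreeIn≡edgeColourDeg edgeColour k v = begin
        degreeIn G (symmetrize edgeColour) k v
          ≡⟨ countB≡sumBy (λ j → adj G v j ∧ does (symmetrize edgeColour v j ≟ k)) ⟩
        sumBy (λ j → ind (adj G v j ∧ does (symmetrize edgeColour v j ≟ k))) (allFin n)
          ≡⟨ sumBy-cong (allFin n) symmetrize-at ⟩
        sumBy (λ j → ind (adj G v j ∧ Q-at v hasColour j)) (allFin n)
          ≡⟨ incidenceSum-by-neighbours v hasColour ⟨
        edgeColourDeg edgeColour k v edges
          ∎
        where
        open ≡-Reasoning
        hasColour : Fin n × Fin n → Bool
        hasColour e = edgeColour e == k
        symmetrize-at : ∀ j → ind (adj G v j ∧ does (symmetrize edgeColour v j ≟ k)) ≡ ind (adj G v j ∧ Q-at v hasColour j)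
        symmetrize-at j with does (v <? j)
        ... | true = refl
        ... | false = refl

  even-factorization : ∀ {n} (G : Graph n) {r a x} → 2 ∣ r → 2 ∣ a → 1 ≤ x →
                       (∀ v → r * x ≤ degree G v × degree G v ≤ (r + a) * x) → HasFactorization G r a x
  even-factorization {n} G {x = suc x'} (divides p refl) (divides q refl) (s≤s z≤n) degree-bounds =
    symmetrize G edgeColour , symmetrize-sym G edgeColour , bounds
    where
    open Edges G
    open Split {Fin n} _≟_ x'

    doubled : ∀ p q → p * 2 + q * 2 ≡ (p + q) + (p + q)
    doubled = solve-∀

    halved : ∀ p → p * 2 ≡ p + p
    halved = solve-∀

    coloured : Σ (Fin n × Fin n → Fin (suc x')) λ edgeColour →
                 ∀ y k → p + p ≤ edgeColourDeg edgeColour k y edges × edgeColourDeg edgeColour k y edges ≤ (p + q) + (p + q)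
    coloured = equitable-colouring p (p + q) edges unique-edges λ y →
      subst₂ (λ D r → r * suc x' ≤ D) (sym (edgeDeg≡degree G x' y)) (halved p) (proj₁ (degree-bounds y)) ,
      subst₂ (λ D r+a → D ≤ r+a * suc x') (sym (edgeDeg≡degree G x' y)) (doubled p q) (proj₂ (degree-bounds y))
    edgeColour : Fin n × Fin n → Fin (suc x')
    edgeColour = proj₁ coloured

    bounds : ∀ k v → p * 2 ≤ degreeIn G (symmetrize G edgeColour) k v × degreeIn G (symmetrize G edgeColour) k v ≤ p * 2 + q * 2
    bounds k v rewrite degreeIn≡edgeColourDeg G x' edgeColour k v =
      subst (_≤ edgeColourDeg edgeColour k v edges) (sym (halved p)) (proj₁ (proj₂ coloured v k)) ,
      subst (edgeColourDeg edgeColour k v edges ≤_) (sym (doubled p q)) (proj₂ (proj₂ coloured v k))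

module FactorCount where

  open import Defs using (ceilDiv)
  open import Data.Nat using (ℕ; suc; _+_; _*_; _∸_; _≤_; _<_; z≤n; s≤s; NonZero; _/_; _%_)
  open import Data.Nat.Properties
  open import Data.Nat.DivMod using (m≡m%n+[m/n]*n; m%n<n; m/n*n≤m; m*n/n≡m; /-monoˡ-≤)
  open import Data.Nat.Tactic.RingSolver using (solve-∀)
  open import Data.Product using (_×_; _,_)
  open import Relation.Binary.PropositionalEquality

  ceilDiv-spec : ∀ m a .{{_ : NonZero a}} → m ≤ ceilDiv m a * a
  ceilDiv-spec m (suc a') = +-cancelʳ-≤ a' m _ (begin
    m + a'                                          ≡⟨ m≡m%n+[m/n]*n (m + a') (suc a') ⟩
    (m + a') % suc a' + (m + a') / suc a' * suc a'  ≤⟨ +-monoˡ-≤ _ (≤-pred (m%n<n (m + a') (suc a'))) ⟩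
    a' + (m + a') / suc a' * suc a'                 ≡⟨ +-comm a' _ ⟩
    (m + a') / suc a' * suc a' + a'                 ≡⟨ cong (λ k → (k ∸ 1) / suc a' * suc a' + a') (+-suc m a') ⟨
    ceilDiv m (suc a') * suc a' + a'                ∎)
    where open ≤-Reasoning

  ≤-quotient : ∀ k d r .{{_ : NonZero r}} → r * k ≤ d → k ≤ d / r
  ≤-quotient k d r rk≤d = begin
    k          ≡⟨ m*n/n≡m k r ⟨
    k * r / r  ≤⟨ /-monoˡ-≤ r (subst (_≤ d) (*-comm r k) rk≤d) ⟩
    d / r      ∎
    where open ≤-Reasoning

  -- x = ⌊d/r⌋ - i satisfies d + s ≤ (r + a) x because the remainder of d together with
  -- the i r dropped from the quotient is at most t r + s - 1 ≤ a ⌈(t r + s - 1)/a⌉ ≤ a x.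
  factorCount-bounds : ∀ r s a t d .{{_ : NonZero r}} .{{_ : NonZero a}} → 2 ≤ r →
    r * ceilDiv (t * r + s ∸ 1) a + (t ∸ 1) * r ≤ d → ∀ i → i < t →
    1 ≤ d / r ∸ i × r * (d / r ∸ i) ≤ d × d + s ≤ (r + a) * (d / r ∸ i)
  factorCount-bounds r@(suc (suc _)) s a (suc t') d (s≤s (s≤s z≤n)) bound i (s≤s i≤t') =
    1≤x , rx≤d , d+s≤[r+a]x
    where
    M c Q x : ℕ
    M = suc t' * r + s ∸ 1
    c = ceilDiv M a
    Q = d / r
    x = Q ∸ i

    c+t'≤Q : c + t' ≤ Q
    c+t'≤Q = ≤-quotient (c + t') d r
      (subst (_≤ d) (sym (*-distribˡ-+ r c t')) (subst (λ k → r * c + k ≤ d) (*-comm t' r) bound))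

    c≤x : c ≤ x
    c≤x = ≤-trans (subst (_≤ Q ∸ t') (m+n∸n≡m c t') (∸-monoˡ-≤ t' c+t'≤Q)) (∸-monoʳ-≤ Q i≤t')

    1≤c : 1 ≤ c
    1≤c with c | ceilDiv-spec M a
    ... | suc _ | _ = s≤s z≤n

    1≤x : 1 ≤ x
    1≤x = ≤-trans 1≤c c≤x

    rx≤d : r * x ≤ d
    rx≤d = begin
      r * (Q ∸ i)  ≤⟨ *-monoʳ-≤ r (m∸n≤m Q i) ⟩
      r * Q        ≡⟨ *-comm r Q ⟩
      Q * r        ≤⟨ m/n*n≤m d r ⟩
      d            ∎
      where open ≤-Reasoning

    Q≡x+i : Q ≡ x + i
    Q≡x+i = sym (m∸n+n≡m (≤-trans i≤t' (≤-trans (m≤n+m t' c) c+t'≤Q)))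

    d+s≤[r+a]x : d + s ≤ (r + a) * x
    d+s≤[r+a]x = begin
      d + s                        ≡⟨ cong (_+ s) (m≡m%n+[m/n]*n d r) ⟩
      d % r + Q * r + s            ≡⟨ cong (λ k → d % r + k * r + s) Q≡x+i ⟩
      d % r + (x + i) * r + s      ≡⟨ regroup (d % r) x i r s ⟩
      x * r + (d % r + i * r + s)  ≤⟨ +-monoʳ-≤ (x * r) (+-monoˡ-≤ s (+-mono-≤ (≤-pred (m%n<n d r)) (*-monoˡ-≤ r i≤t'))) ⟩
      x * r + M                    ≤⟨ +-monoʳ-≤ (x * r) (ceilDiv-spec M a) ⟩
      x * r + c * a                ≤⟨ +-monoʳ-≤ (x * r) (*-monoˡ-≤ a c≤x) ⟩
      x * r + x * a                ≡⟨ *-distribˡ-+ x r a ⟨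
      x * (r + a)                  ≡⟨ *-comm x (r + a) ⟩
      (r + a) * x                  ∎
      where
      open ≤-Reasoning
      regroup : ∀ m x i r s → m + (x + i) * r + s ≡ x * r + (m + i * r + s)
      regroup = solve-∀

open import Defs
open FactorCount
open EvenFactorization
open import Data.Nat using (ℕ; _+_; _*_; _∸_; _≤_; NonZero; >-nonZero; _/_; s≤s; z≤n)
open import Data.Nat.Properties using (≤-trans; m∸n≢0⇒n<m; m<n⇒n≢0; <⇒≤; ∸-cancelˡ-≡)
open import Data.Nat.Divisibility using (_∣_)
open import Data.Fin using (Fin; toℕ)
open import Data.Fin.Properties using (toℕ<n; toℕ-injective)
open import Data.Product using (_×_; _,_; proj₁; proj₂)
open import Relation.Binary.PropositionalEquality using (_≡_)

lemma21 : (r s a t : ℕ) → 2 ≤ r → 2 ∣ r → 2 ≤ a → 2 ∣ a → 1 ≤ t →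
          .{{_ : NonZero a}} →
          ∀ (d : ℕ) → r * ceilDiv (t * r + s ∸ 1) a + (t ∸ 1) * r ≤ d →
          ∀ (n : ℕ) (G : Graph n) → IsDegRangeGraph d s G →
          HasManyFactorizations G r a t
lemma21 r s a t 2≤r 2∣r _ 2∣a _ d d-large n G deg-range = factorCount , factorCount-injective , factorization
  where
  instance
    r-nonZero : NonZero r
    r-nonZero = >-nonZero (≤-trans (s≤s z≤n) 2≤r)

  factorCount : Fin t → ℕ
  factorCount i = d / r ∸ toℕ i

  bounds : ∀ i → 1 ≤ factorCount i × r * factorCount i ≤ d × d + s ≤ (r + a) * factorCount i
  bounds i = factorCount-bounds r s a t d 2≤r d-large (toℕ i) (toℕ<n i)

  i≤d/r : ∀ i → toℕ i ≤ d / r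
  i≤d/r i = <⇒≤ (m∸n≢0⇒n<m (m<n⇒n≢0 (proj₁ (bounds i))))

  factorCount-injective : ∀ {i j} → factorCount i ≡ factorCount j → i ≡ j
  factorCount-injective {i} {j} eq = toℕ-injective (∸-cancelˡ-≡ (i≤d/r i) (i≤d/r j) eq)

  factorization : ∀ i → HasFactorization G r a (factorCount i)
  factorization i = even-factorization G 2∣r 2∣a (proj₁ (bounds i)) λ v →
    ≤-trans (proj₁ (proj₂ (bounds i))) (proj₁ (deg-range v)) ,
    ≤-trans (proj₂ (deg-range v)) (proj₂ (proj₂ (bounds i)))
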